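{- Let $q\neq2$ be a prime. Then for any $\xi,n\in\mathbb{Z}$ and any $k_2\in\mathbb{Z}_{\ge0}$, \[q^{ -\frac{\min\{v_q(n),2k_2\}}{2}}Kl_{1,q^{k_2}}(\xi,n)=\delta(4n;q^{2k_2})\begin{cases}1 & v_q(\xi)\ge k_2,\ v_q(n)\ge2k_2,\\ 2\cos\!\left(\frac{2\pi\cdot 2\sqrt n\,\xi}{q^{2k_2}}\right) & 2v_q(\xi)\ge v_q(n),\ v_q(n)<2k_2,\\ 0 & \text{otherwise}.\end{cases}\] Here, in the second case (where $\delta(4n;q^{2k_2})=1$ forces $v_q(n)=2r$ even), $\sqrt n:=q^{r}s$ with $s$ an integer satisfying $s^2\equiv n/q^{2r}\pmod{q^{2k_2-2r}}$.
   Context: For an odd prime $q$ and $k_2\ge0$, $Kl_{1,q^{k_2}}(\xi,n):=\sum_{a\bmod q^{2k_2},\ a^2\equiv4n\bmod q^{2k_2}}e\!\left(\frac{a\xi}{q^{2k_2}}\right)$, with $e(x)=e^{2\pi ix}$. $v_q$ is the $q$-adic valuation. For integers $a$ and $b>0$, $\delta(a;b)=1$ if $x^2\equiv a\bmod b$ has a solution and $0$ otherwise. -}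

module Defs where

open import Level using (Level)
open import Algebra.Bundles using (CommutativeRing)
open import Data.Nat as ℕ using (ℕ; zero; suc; NonZero)
open import Data.Nat.Properties using (_≟_; m^n≢0)
open import Data.Integer as ℤ using (ℤ; +_; _%ℕ_)
open import Data.Integer.Divisibility as ℤD using ()
open import Data.Product using (∃)
open import Relation.Nullary using (yes; no)
open import Relation.Binary.PropositionalEquality using (_≡_)

_≡_[mod_] : ℤ → ℤ → ℕ → Set
x ≡ y [mod N ] = (+ N) ℤD.∣ (x ℤ.- y)

-- x mod q^j as a natural number in [0, q^j) (junk value 0 when q = 0,
-- which never occurs since q is prime in the statement).
res : ℕ → ℕ → ℤ → ℕ
res zero    j x = 0
res (suc p) j x = _%ℕ_ x (suc p ℕ.^ j) {{m^n≢0 (suc p) j}}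

-- δ(a; b) = 1 iff x² ≡ a (mod b) is solvable (we use the proposition).
δ : ℤ → ℕ → Set
δ a b = ∃ λ (x : ℤ) → (x ℤ.* x) ≡ a [mod b ]

-- Everything involving e(·) is computed in a commutative ring R containing an
-- element ζ which is a root of the cyclotomic polynomial Φ_{q^j}; the complex
-- number e(1/q^j) is the universal such element (Z[x]/Φ ≅ Z[e(1/q^j)] ⊂ ℂ).
module InRing {c ℓ : Level} (R : CommutativeRing c ℓ) where
  open CommutativeRing R

  pow : Carrier → ℕ → Carrier
  pow x zero    = 1#
  pow x (suc m) = x * pow x m

  ι : ℕ → Carrier
  ι zero    = 0#
  ι (suc m) = 1# + ι m

  Σ< : ℕ → (ℕ → Carrier) → Carrier
  Σ< zero    f = 0#
  Σ< (suc m) f = Σ< m f + f m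

  -- Φ_{q^j}(ζ) ≈ 0, where Φ_1(x) = x - 1 and Φ_{q^{j+1}}(x) = Σ_{i<q} x^{i q^j}
  CycloRoot : ℕ → ℕ → Carrier → Set ℓ
  CycloRoot q zero    ζ = ζ ≈ 1#
  CycloRoot q (suc j) ζ = Σ< q (λ i → pow ζ (i ℕ.* (q ℕ.^ j))) ≈ 0#

  -- Kl_{1,q^k}(ξ,n) = Σ_{a mod N, a² ≡ 4n mod N} e(aξ/N), N = q^{2k},
  -- with e(m/N) represented by ζ^(m mod N).
  Kl : (q k : ℕ) → Carrier → ℤ → ℤ → Carrier
  Kl q k ζ ξ n = Σ< (q ℕ.^ (2 ℕ.* k)) term
    where
      term : ℕ → Carrier
      term a with res q (2 ℕ.* k) ((+ a ℤ.* + a) ℤ.- (+ 4 ℤ.* n)) ≟ 0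
      ... | yes _ = pow ζ (res q (2 ℕ.* k) (+ a ℤ.* ξ))
      ... | no  _ = 0#

module Submission where

-- Let r + j = 2k with r ≤ j, and suppose every root a of a² ≡ 4n (mod N) is
-- divisible by q^r (true when q^(2r) ∣ n).  Writing a = c q^j + u with c < q^r, u < q^j,
-- a is a root iff u is, so the sum factors as
--   Kl = S(r, j) · Σ_{u < q^j root} e(uξ/N),   S(r, j) = Σ_{c < q^r} e(c q^j ξ/N).
-- The character sum S(r, j) equals q^r if q^r ∣ ξ and vanishes otherwise, by orthogonality:
-- for q ∤ a, i ↦ i a permutes the residues mod q, so Σ_{i<q} ζ^(i a q^(2k-1)) = Φ_N(ζ) = 0.
-- Taking r = j = k when N ∣ n (then 0 is the only root below q^k), resp. v_q(n) = 2r < 2k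
-- and j = 2k - r (then, for s² ≡ n/q^(2r) mod q^(2k-2r), the roots below q^j are exactly the
-- residues of ±2 q^r s), gives the four cases of the statement.

open import Defs
open import Algebra.Bundles using (CommutativeRing)
open import Data.Nat as ℕ using (ℕ; _<_)
open import Data.Nat.Primality using (Prime)
open import Data.Integer as ℤ using (ℤ; +_)
open import Data.Integer.Divisibility as ℤD using ()
open import Data.Product using (_×_; ∃)
open import Relation.Nullary using (¬_)
open import Relation.Binary.PropositionalEquality using (_≡_; _≢_)

open import Data.Nat using (zero; suc; _≤_; NonZero)
import Data.Nat.Properties as ℕP
import Data.Nat.DivMod as ℕDM
import Data.Nat.Divisibility as ℕD
open ℕD using (_∣_; divides; _∣?_)
open import Data.Nat.Primality using (euclidsLemma; ¬prime[0]; prime⇒nonZero; prime⇒nonTrivial)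
open import Data.Nat.Coprimality using (prime⇒coprime; coprime-Bézout)
open import Data.Nat.GCD using (module Bézout)
import Data.Nat.Tactic.RingSolver as ℕSolver
open import Data.Integer using (_%ℕ_)
import Data.Integer.Properties as ℤP
import Data.Integer.DivMod as ℤDM
import Data.Integer.Divisibility.Signed as ℤS
open ℤS using () renaming (_∣_ to _∣ℤ_)
open import Data.Integer.Tactic.RingSolver using (solve-∀)
open import Data.Fin using (Fin; toℕ; fromℕ<)
import Data.Fin.Properties as FinP
open import Data.Fin.Permutation using (Permutation; permutation)
open import Data.Product using (Σ; _,_; proj₁; proj₂; uncurry)
open import Data.Sum as Sum using (_⊎_; inj₁; inj₂)
open import Relation.Nullary using (yes; no; contradiction)
open import Relation.Binary.PropositionalEquality as ≡ using ()
import Algebra.Properties.CommutativeMonoid.Sum as MonoidSum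

module FiniteSums {c ℓ} (R : CommutativeRing c ℓ) where
  open CommutativeRing R
  open InRing R
  open import Relation.Binary.Reasoning.Setoid setoid

  below-pred : ∀ {i m} → i < suc m → i ≢ m → i < m
  below-pred i<1+m i≢m = ℕP.≤∧≢⇒< (ℕP.≤-pred i<1+m) i≢m

  Σ<-cong : ∀ m {f g : ℕ → Carrier} → (∀ i → i < m → f i ≈ g i) → Σ< m f ≈ Σ< m g
  Σ<-cong zero    f≈g = refl
  Σ<-cong (suc m) f≈g = +-cong (Σ<-cong m (λ i i<m → f≈g i (ℕP.m<n⇒m<1+n i<m))) (f≈g m ℕP.≤-refl)

  Σ<-zero : ∀ m {f : ℕ → Carrier} → (∀ i → i < m → f i ≈ 0#) → Σ< m f ≈ 0#
  Σ<-zero m f≈0 = trans (Σ<-cong m f≈0) (zeros m)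
    where
    zeros : ∀ m → Σ< m (λ _ → 0#) ≈ 0#
    zeros zero    = refl
    zeros (suc m) = trans (+-identityʳ _) (zeros m)

  Σ<-one : ∀ m {f : ℕ → Carrier} → (∀ i → i < m → f i ≈ 1#) → Σ< m f ≈ ι m
  Σ<-one zero    f≈1 = refl
  Σ<-one (suc m) f≈1 =
    trans (+-cong (Σ<-one m (λ i i<m → f≈1 i (ℕP.m<n⇒m<1+n i<m))) (f≈1 m ℕP.≤-refl)) (+-comm _ _)

  Σ<-single : ∀ m {u x} (f : ℕ → Carrier) → u < m → f u ≈ x →
    (∀ i → i < m → i ≢ u → f i ≈ 0#) → Σ< m f ≈ x
  Σ<-single (suc m) {u} f u<1+m fu≈x off-u with m ℕ.≟ u
  ... | yes ≡.refl = begin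
    Σ< m f + f m ≈⟨ +-cong (Σ<-zero m λ i i<m → off-u i (ℕP.m<n⇒m<1+n i<m) (ℕP.<⇒≢ i<m)) fu≈x ⟩
    0# + _       ≈⟨ +-identityˡ _ ⟩
    _            ∎
  ... | no m≢u = begin
    Σ< m f + f m ≈⟨ +-cong (Σ<-single m f u<m fu≈x (λ i i<m → off-u i (ℕP.m<n⇒m<1+n i<m)))
                           (off-u m ℕP.≤-refl m≢u) ⟩
    _ + 0#       ≈⟨ +-identityʳ _ ⟩
    _            ∎
    where
    u<m : u < m
    u<m = below-pred u<1+m (λ u≡m → m≢u (≡.sym u≡m))

  Σ<-pair : ∀ m {u v x y} (f : ℕ → Carrier) → u < m → v < m → u ≢ v → f u ≈ x → f v ≈ y →
    (∀ i → i < m → i ≢ u → i ≢ v → f i ≈ 0#) → Σ< m f ≈ x + y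
  Σ<-pair (suc m) {u} {v} {x} {y} f u<1+m v<1+m u≢v fu≈x fv≈y off with m ℕ.≟ u | m ℕ.≟ v
  ... | yes ≡.refl | _ = begin
    Σ< m f + f m ≈⟨ +-cong (Σ<-single m f (below-pred v<1+m (λ v≡m → u≢v (≡.sym v≡m))) fv≈y
                             (λ i i<m → off i (ℕP.m<n⇒m<1+n i<m) (ℕP.<⇒≢ i<m))) fu≈x ⟩
    y + x        ≈⟨ +-comm y x ⟩
    x + y        ∎
  ... | no _ | yes ≡.refl =
    +-cong (Σ<-single m f (below-pred u<1+m u≢v) fu≈x
             (λ i i<m i≢u → off i (ℕP.m<n⇒m<1+n i<m) i≢u (ℕP.<⇒≢ i<m))) fv≈y
  ... | no m≢u | no m≢v = begin
    Σ< m f + f m ≈⟨ +-cong (Σ<-pair m f (below-pred u<1+m (λ u≡m → m≢u (≡.sym u≡m)))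
                                        (below-pred v<1+m (λ v≡m → m≢v (≡.sym v≡m)))
                                        u≢v fu≈x fv≈y (λ i i<m → off i (ℕP.m<n⇒m<1+n i<m)))
                           (off m ℕP.≤-refl m≢u m≢v) ⟩
    (x + y) + 0# ≈⟨ +-identityʳ _ ⟩
    x + y        ∎

  Σ<-*ˡ : ∀ m x (f : ℕ → Carrier) → x * Σ< m f ≈ Σ< m (λ i → x * f i)
  Σ<-*ˡ zero    x f = zeroʳ x
  Σ<-*ˡ (suc m) x f = trans (distribˡ x _ _) (+-congʳ (Σ<-*ˡ m x f))

  Σ<-*ʳ : ∀ m x (f : ℕ → Carrier) → Σ< m f * x ≈ Σ< m (λ i → f i * x)
  Σ<-*ʳ zero    x f = zeroˡ x
  Σ<-*ʳ (suc m) x f = trans (distribʳ x _ _) (+-congʳ (Σ<-*ʳ m x f))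

  Σ<-+ : ∀ a b (f : ℕ → Carrier) → Σ< (a ℕ.+ b) f ≈ Σ< a f + Σ< b (λ i → f (a ℕ.+ i))
  Σ<-+ a zero    f rewrite ℕP.+-identityʳ a = sym (+-identityʳ _)
  Σ<-+ a (suc b) f rewrite ℕP.+-suc a b = begin
    Σ< (a ℕ.+ b) f + f (a ℕ.+ b)                      ≈⟨ +-congʳ (Σ<-+ a b f) ⟩
    (Σ< a f + Σ< b (λ i → f (a ℕ.+ i))) + f (a ℕ.+ b) ≈⟨ +-assoc _ _ _ ⟩
    Σ< a f + (Σ< b (λ i → f (a ℕ.+ i)) + f (a ℕ.+ b)) ∎

  -- An index below M d is written uniquely as c d + u with c < M, u < d.
  Σ<-blocks : ∀ M d (f : ℕ → Carrier) →
    Σ< (M ℕ.* d) f ≈ Σ< M (λ c → Σ< d (λ u → f (c ℕ.* d ℕ.+ u)))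
  Σ<-blocks zero    d f = refl
  Σ<-blocks (suc M) d f = begin
    Σ< (d ℕ.+ M ℕ.* d) f                            ≡⟨ ≡.cong (λ z → Σ< z f) (ℕP.+-comm d (M ℕ.* d)) ⟩
    Σ< (M ℕ.* d ℕ.+ d) f                            ≈⟨ Σ<-+ (M ℕ.* d) d f ⟩
    Σ< (M ℕ.* d) f + Σ< d (λ u → f (M ℕ.* d ℕ.+ u)) ≈⟨ +-congʳ (Σ<-blocks M d f) ⟩
    Σ< M (λ c → Σ< d (λ u → f (c ℕ.* d ℕ.+ u))) + Σ< d (λ u → f (M ℕ.* d ℕ.+ u)) ∎

  Σ<-factor : ∀ M d (f A B : ℕ → Carrier) →
    (∀ c u → c < M → u < d → f (c ℕ.* d ℕ.+ u) ≈ A c * B u) →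
    Σ< (M ℕ.* d) f ≈ Σ< M A * Σ< d B
  Σ<-factor M d f A B split = begin
    Σ< (M ℕ.* d) f                              ≈⟨ Σ<-blocks M d f ⟩
    Σ< M (λ c → Σ< d (λ u → f (c ℕ.* d ℕ.+ u))) ≈⟨ Σ<-cong M inner ⟩
    Σ< M (λ c → A c * Σ< d B)                   ≈⟨ Σ<-*ʳ M (Σ< d B) A ⟨
    Σ< M A * Σ< d B                             ∎
    where
    inner : ∀ c → c < M → Σ< d (λ u → f (c ℕ.* d ℕ.+ u)) ≈ A c * Σ< d B
    inner c c<M = trans (Σ<-cong d (λ u u<d → split c u c<M u<d)) (sym (Σ<-*ˡ d (A c) B))

  -- Σ< agrees with the library's sum over Fin m, which is invariant under permutations.
  private
    module Library = MonoidSum +-commutativeMonoid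

  Σ<-shift : ∀ m (f : ℕ → Carrier) → Σ< (suc m) f ≈ f 0 + Σ< m (λ i → f (suc i))
  Σ<-shift zero    f = +-comm _ _
  Σ<-shift (suc m) f = trans (+-congʳ (Σ<-shift m f)) (+-assoc _ _ _)

  Σ<≈sum : ∀ m (f : ℕ → Carrier) → Σ< m f ≈ Library.sum {m} (λ i → f (toℕ i))
  Σ<≈sum zero    f = refl
  Σ<≈sum (suc m) f = trans (Σ<-shift m f) (+-congˡ (Σ<≈sum m (λ i → f (suc i))))

  Σ<-permute : ∀ m (h : ℕ → Carrier) (π π⁻¹ : ℕ → ℕ) →
    (∀ i → i < m → π i < m) → (∀ i → i < m → π⁻¹ i < m) →
    (∀ i → i < m → π (π⁻¹ i) ≡ i) → (∀ i → i < m → π⁻¹ (π i) ≡ i) →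
    Σ< m (λ i → h (π i)) ≈ Σ< m h
  Σ<-permute m h π π⁻¹ π< π⁻¹< ππ⁻¹ π⁻¹π = begin
    Σ< m (λ i → h (π i))                  ≈⟨ Σ<≈sum m (λ i → h (π i)) ⟩
    Library.sum {m} (λ i → h (π (toℕ i))) ≡⟨ Library.sum-cong-≗ {m} (λ i → ≡.cong h (≡.sym (FinP.toℕ-fromℕ< _))) ⟩
    Library.sum {m} (λ i → h (toℕ (σ i))) ≈⟨ Library.sum-permute {m} {m} (λ i → h (toℕ i)) σ-perm ⟨
    Library.sum {m} (λ i → h (toℕ i))     ≈⟨ Σ<≈sum m h ⟨
    Σ< m h                                ∎
    where
    lift : (g : ℕ → ℕ) → (∀ i → i < m → g i < m) → Fin m → Fin m
    lift g g< i = fromℕ< (g< (toℕ i) (FinP.toℕ<n i))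
    σ : Fin m → Fin m
    σ = lift π π<
    lift-inverse : ∀ g g⁻¹ g< g⁻¹< → (∀ i → i < m → g (g⁻¹ i) ≡ i) →
      ∀ i → lift g g< (lift g⁻¹ g⁻¹< i) ≡ i
    lift-inverse g g⁻¹ g< g⁻¹< inverse i = FinP.toℕ-injective
      (≡.trans (FinP.toℕ-fromℕ< _) (≡.trans (≡.cong g (FinP.toℕ-fromℕ< _)) (inverse (toℕ i) (FinP.toℕ<n i))))
    σ-perm : Permutation m m
    σ-perm = permutation σ (lift π⁻¹ π⁻¹<) (lift-inverse π π⁻¹ π< π⁻¹< ππ⁻¹) (lift-inverse π⁻¹ π π⁻¹< π< π⁻¹π)

module Powers {c ℓ} (R : CommutativeRing c ℓ) where
  open CommutativeRing R
  open InRing R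
  open FiniteSums R using (Σ<-cong)
  open import Relation.Binary.Reasoning.Setoid setoid

  pow-cong : ∀ {x y} m → x ≈ y → pow x m ≈ pow y m
  pow-cong zero    x≈y = refl
  pow-cong (suc m) x≈y = *-cong x≈y (pow-cong m x≈y)

  pow-+ : ∀ x a b → pow x (a ℕ.+ b) ≈ pow x a * pow x b
  pow-+ x zero    b = sym (*-identityˡ _)
  pow-+ x (suc a) b = trans (*-congˡ (pow-+ x a b)) (sym (*-assoc _ _ _))

  pow-* : ∀ x a b → pow x (a ℕ.* b) ≈ pow (pow x a) b
  pow-* x a zero    rewrite ℕP.*-zeroʳ a = refl
  pow-* x a (suc b) rewrite ℕP.*-suc a b = trans (pow-+ x a (a ℕ.* b)) (*-congˡ (pow-* x a b))

  pow-1# : ∀ b → pow 1# b ≈ 1#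
  pow-1# zero    = refl
  pow-1# (suc b) = trans (*-identityˡ _) (pow-1# b)

  pow-mod : ∀ x M .{{_ : NonZero M}} → pow x M ≈ 1# → ∀ m → pow x m ≈ pow x (m ℕ.% M)
  pow-mod x M xᴹ≈1 m = begin
    pow x m                                   ≡⟨ ≡.cong (pow x) (ℕDM.m≡m%n+[m/n]*n m M) ⟩
    pow x (m ℕ.% M ℕ.+ (m ℕ./ M) ℕ.* M)       ≈⟨ pow-+ x (m ℕ.% M) _ ⟩
    pow x (m ℕ.% M) * pow x ((m ℕ./ M) ℕ.* M) ≡⟨ ≡.cong (λ a → pow x (m ℕ.% M) * pow x a) (ℕP.*-comm (m ℕ./ M) M) ⟩
    pow x (m ℕ.% M) * pow x (M ℕ.* (m ℕ./ M)) ≈⟨ *-congˡ (pow-* x M (m ℕ./ M)) ⟩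
    pow x (m ℕ.% M) * pow (pow x M) (m ℕ./ M) ≈⟨ *-congˡ (trans (pow-cong (m ℕ./ M) xᴹ≈1) (pow-1# (m ℕ./ M))) ⟩
    pow x (m ℕ.% M) * 1#                      ≈⟨ *-identityʳ _ ⟩
    pow x (m ℕ.% M)                           ∎

  geometric : ∀ y m → y * Σ< m (pow y) + 1# ≈ Σ< m (pow y) + pow y m
  geometric y zero    = +-congʳ (zeroʳ y)
  geometric y (suc m) = begin
    y * (Σ< m (pow y) + pow y m) + 1#        ≈⟨ +-congʳ (distribˡ y _ _) ⟩
    (y * Σ< m (pow y) + y * pow y m) + 1#    ≈⟨ +-assoc _ _ _ ⟩
    y * Σ< m (pow y) + (y * pow y m + 1#)    ≈⟨ +-congˡ (+-comm _ _) ⟩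
    y * Σ< m (pow y) + (1# + y * pow y m)    ≈⟨ +-assoc _ _ _ ⟨
    (y * Σ< m (pow y) + 1#) + y * pow y m    ≈⟨ +-congʳ (geometric y m) ⟩
    (Σ< m (pow y) + pow y m) + pow y (suc m) ∎

  -- A root ζ of Φ_{q^j} satisfies ζ^(q^j) = 1: for j = j' + 1 put y = ζ^(q^j');
  -- then Σ_{i<q} yⁱ = 0, and the telescoping identity gives 1 = y^q.
  cycloRoot⇒pow≈1 : ∀ q j ζ → CycloRoot q j ζ → pow ζ (q ℕ.^ j) ≈ 1#
  cycloRoot⇒pow≈1 q zero    ζ ζ≈1  = trans (*-identityʳ ζ) ζ≈1
  cycloRoot⇒pow≈1 q (suc j) ζ Φζ≈0 = begin
    pow ζ (q ℕ.* q ℕ.^ j)  ≡⟨ ≡.cong (pow ζ) (ℕP.*-comm q (q ℕ.^ j)) ⟩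
    pow ζ (q ℕ.^ j ℕ.* q)  ≈⟨ pow-* ζ (q ℕ.^ j) q ⟩
    pow y q                ≈⟨ +-identityˡ _ ⟨
    0# + pow y q           ≈⟨ +-congʳ Σyⁱ≈0 ⟨
    Σ< q (pow y) + pow y q ≈⟨ geometric y q ⟨
    y * Σ< q (pow y) + 1#  ≈⟨ +-congʳ (trans (*-congˡ Σyⁱ≈0) (zeroʳ y)) ⟩
    0# + 1#                ≈⟨ +-identityˡ _ ⟩
    1#                     ∎
    where
    y : Carrier
    y = pow ζ (q ℕ.^ j)
    yⁱ≈ζ^[iq^j] : ∀ i → pow y i ≈ pow ζ (i ℕ.* q ℕ.^ j)
    yⁱ≈ζ^[iq^j] i = sym (trans (reflexive (≡.cong (pow ζ) (ℕP.*-comm i (q ℕ.^ j)))) (pow-* ζ (q ℕ.^ j) i))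
    Σyⁱ≈0 : Σ< q (pow y) ≈ 0#
    Σyⁱ≈0 = trans (Σ<-cong q (λ i _ → yⁱ≈ζ^[iq^j] i)) Φζ≈0

module Congruences where

  ∣-abs⇒∣ℤ : ∀ {a x} → a ∣ ℤ.∣ x ∣ → + a ∣ℤ x
  ∣-abs⇒∣ℤ {a} {x} = ℤS.∣ᵤ⇒∣ {+ a} {x}

  ∣ℤ⇒∣-abs : ∀ {a x} → + a ∣ℤ x → a ∣ ℤ.∣ x ∣
  ∣ℤ⇒∣-abs {a} {x} = ℤS.∣⇒∣ᵤ {+ a} {x}

  ∣⇒∣ℤ : ∀ {a b} → a ∣ b → + a ∣ℤ + b
  ∣⇒∣ℤ {a} {b} = ∣-abs⇒∣ℤ {a} {+ b}

  ∣ℤ-* : ∀ {a b x y} → + a ∣ℤ x → + b ∣ℤ y → + (a ℕ.* b) ∣ℤ x ℤ.* y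
  ∣ℤ-* {a} {b} {x} {y} a∣x b∣y = ∣-abs⇒∣ℤ {a ℕ.* b} {x ℤ.* y}
    (≡.subst ((a ℕ.* b) ∣_) (≡.sym (ℤP.abs-* x y)) (ℕD.*-pres-∣ (∣ℤ⇒∣-abs a∣x) (∣ℤ⇒∣-abs b∣y)))

  ∣-sub⇒∣ˡ : ∀ {D X Y} → D ∣ℤ X ℤ.- Y → D ∣ℤ Y → D ∣ℤ X
  ∣-sub⇒∣ˡ D∣X-Y D∣Y = ℤS.∣m+n∣n⇒∣m D∣X-Y (ℤS.∣m⇒∣-m D∣Y)

  ∣-sub⇒∣ʳ : ∀ {D X Y} → D ∣ℤ X ℤ.- Y → D ∣ℤ X → D ∣ℤ Y
  ∣-sub⇒∣ʳ {D} {X} {Y} D∣X-Y D∣X =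
    ≡.subst (D ∣ℤ_) (ℤP.neg-involutive Y) (ℤS.∣m⇒∣-m (ℤS.∣m+n∣m⇒∣n D∣X-Y D∣X))

  ∣-sub-sym : ∀ {D X Y} → D ∣ℤ X ℤ.- Y → D ∣ℤ Y ℤ.- X
  ∣-sub-sym {D} {X} {Y} D∣X-Y = ≡.subst (D ∣ℤ_) (negate X Y) (ℤS.∣m⇒∣-m D∣X-Y)
    where
    negate : ∀ X Y → ℤ.- (X ℤ.- Y) ≡ Y ℤ.- X
    negate = solve-∀

  multiple-below : ∀ {d z} → z < d → d ∣ z → z ≡ 0
  multiple-below {z = zero}  _   _   = ≡.refl
  multiple-below {z = suc z} z<d d∣z = contradiction d∣z (ℕD.>⇒∤ z<d)

  residue-unique-≤ : ∀ {d x y} → y ≤ x → x < d → d ∣ ℤ.∣ + x ℤ.- + y ∣ → x ≡ y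
  residue-unique-≤ {d} {x} {y} y≤x x<d d∣x-y = ℕP.≤-antisym (ℕP.m∸n≡0⇒m≤n x∸y≡0) y≤x
    where
    x∸y≡0 : x ℕ.∸ y ≡ 0
    x∸y≡0 = multiple-below (ℕP.≤-<-trans (ℕP.m∸n≤m x y) x<d)
              (≡.subst (d ∣_) (≡.cong ℤ.∣_∣ (≡.trans (ℤP.m-n≡m⊖n x y) (ℤP.⊖-≥ y≤x))) d∣x-y)

  residue-unique : ∀ {d a b} → a < d → b < d → d ∣ ℤ.∣ + a ℤ.- + b ∣ → a ≡ b
  residue-unique {d} {a} {b} a<d b<d d∣a-b with ℕP.≤-total b a
  ... | inj₁ b≤a = residue-unique-≤ b≤a a<d d∣a-b
  ... | inj₂ a≤b = ≡.sym (residue-unique-≤ a≤b b<d (≡.subst (d ∣_) (ℤP.∣i-j∣≡∣j-i∣ (+ a) (+ b)) d∣a-b))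

  ∣-residue : ∀ d .{{_ : NonZero d}} x → + d ∣ℤ x ℤ.- + (x %ℕ d)
  ∣-residue d x = ℤS.divides (x ℤ./ℕ d)
      (≡.trans (≡.cong (ℤ._- + (x %ℕ d)) (ℤDM.a≡a%ℕn+[a/ℕn]*n x d)) (cancel (+ (x %ℕ d)) (x ℤ./ℕ d) (+ d)))
    where
    cancel : ∀ r Q D → (r ℤ.+ Q ℤ.* D) ℤ.- r ≡ Q ℤ.* D
    cancel = solve-∀

  %ℕ-cong : ∀ d .{{_ : NonZero d}} x y → + d ∣ℤ x ℤ.- y → x %ℕ d ≡ y %ℕ d
  %ℕ-cong d x y d∣x-y = residue-unique (ℤDM.n%ℕd<d x d) (ℤDM.n%ℕd<d y d) (∣ℤ⇒∣-abs d∣rx-ry)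
    where
    rx ry : ℤ
    rx = + (x %ℕ d)
    ry = + (y %ℕ d)
    regroup : ∀ x y rx ry → rx ℤ.- ry ≡ ((x ℤ.- y) ℤ.- (x ℤ.- rx)) ℤ.+ (y ℤ.- ry)
    regroup = solve-∀
    d∣rx-ry : + d ∣ℤ rx ℤ.- ry
    d∣rx-ry = ≡.subst (+ d ∣ℤ_) (≡.sym (regroup x y rx ry))
                (ℤS.∣m∣n⇒∣m+n (ℤS.∣m∣n⇒∣m-n d∣x-y (∣-residue d x)) (∣-residue d y))

  %ℕ-unique : ∀ d .{{_ : NonZero d}} {u} y → u < d → + d ∣ℤ + u ℤ.- y → u ≡ y %ℕ d
  %ℕ-unique d {u} y u<d d∣u-y = ≡.trans (≡.sym (ℕDM.m<n⇒m%n≡m u<d)) (%ℕ-cong d (+ u) y d∣u-y)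

  ∣⇒%ℕ≡0 : ∀ d .{{_ : NonZero d}} x → + d ∣ℤ x → x %ℕ d ≡ 0
  ∣⇒%ℕ≡0 d x d∣x = ≡.trans (%ℕ-cong d x (+ 0) (≡.subst (+ d ∣ℤ_) (≡.sym (ℤP.+-identityʳ x)) d∣x))
                           (ℕDM.m*n%n≡0 0 d)

  %ℕ≡0⇒∣ : ∀ d .{{_ : NonZero d}} x → x %ℕ d ≡ 0 → + d ∣ℤ x
  %ℕ≡0⇒∣ d x x%d≡0 = ≡.subst (+ d ∣ℤ_) (ℤP.+-identityʳ x)
                       (≡.subst (λ r → + d ∣ℤ x ℤ.- + r) x%d≡0 (∣-residue d x))

module Exponents where

  ^-+ : ∀ m a b → m ℕ.^ (a ℕ.+ b) ≡ m ℕ.^ a ℕ.* m ℕ.^ b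
  ^-+ = ℕP.^-distribˡ-+-*

  ^-double : ∀ m r → m ℕ.^ (2 ℕ.* r) ≡ m ℕ.^ r ℕ.* m ℕ.^ r
  ^-double m r = ≡.trans (^-+ m r (r ℕ.+ 0)) (≡.cong (λ s → m ℕ.^ r ℕ.* m ℕ.^ s) (ℕP.+-identityʳ r))

  ^-mono-∣ : ∀ m {a b} → a ≤ b → m ℕ.^ a ∣ m ℕ.^ b
  ^-mono-∣ m {a} {b} a≤b = divides (m ℕ.^ (b ℕ.∸ a))
    (≡.trans (≡.cong (m ℕ.^_) (≡.sym (ℕP.m+[n∸m]≡n a≤b)))
             (≡.trans (^-+ m a (b ℕ.∸ a)) (ℕP.*-comm (m ℕ.^ a) _)))

  valuation-split : ∀ m M x → m ℕ.^ M ∣ x ⊎ ∃ λ v → v < M × m ℕ.^ v ∣ x × ¬ m ℕ.^ suc v ∣ x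
  valuation-split m zero    x = inj₁ (ℕD.1∣ x)
  valuation-split m (suc M) x with valuation-split m M x
  ... | inj₂ (v , v<M , mᵛ∣x , mᵛ⁺¹∤x) = inj₂ (v , ℕP.m<n⇒m<1+n v<M , mᵛ∣x , mᵛ⁺¹∤x)
  ... | inj₁ mᴹ∣x with m ℕ.^ suc M ∣? x
  ...   | yes mᴹ⁺¹∣x = inj₁ mᴹ⁺¹∣x
  ...   | no  mᴹ⁺¹∤x = inj₂ (M , ℕP.≤-refl , mᴹ∣x , mᴹ⁺¹∤x)

even-or-odd : ∀ m → ∃ λ r → m ≡ 2 ℕ.* r ⊎ m ≡ suc (2 ℕ.* r)
even-or-odd zero    = 0 , inj₁ ≡.refl
even-or-odd (suc m) with even-or-odd m
... | r , inj₁ m≡2r   = r , inj₂ (≡.cong suc m≡2r)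
... | r , inj₂ m≡2r+1 = suc r , inj₁ (≡.cong suc (≡.trans m≡2r+1 (≡.sym (ℕP.+-suc r (r ℕ.+ 0)))))

module PrimePowers (q : ℕ) (q-prime : Prime q) where
  open Exponents
  open Congruences

  instance
    q≢0 : NonZero q
    q≢0 = prime⇒nonZero q-prime

  q^e≢0 : ∀ e → NonZero (q ℕ.^ e)
  q^e≢0 e = ℕP.m^n≢0 q e

  q∣q^e : ∀ {e} → 1 ≤ e → q ∣ q ℕ.^ e
  q∣q^e {suc e} _ = ℕD.m∣m*n (q ℕ.^ e)

  prime-∣-square : ∀ a → q ∣ a ℕ.* a → q ∣ a
  prime-∣-square a q∣a² with euclidsLemma a a q-prime q∣a²
  ... | inj₁ q∣a = q∣a
  ... | inj₂ q∣a = q∣a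

  odd-prime∤4 : q ≢ 2 → ¬ q ∣ 4
  odd-prime∤4 q≢2 q∣4 = q≢2 (ℕP.≤-antisym (ℕD.∣⇒≤ (prime-∣-square 2 q∣4))
                                          (ℕ.nonTrivial⇒n>1 q {{prime⇒nonTrivial q-prime}}))

  private
    square-* : ∀ b c → (b ℕ.* c) ℕ.* (b ℕ.* c) ≡ (c ℕ.* c) ℕ.* (b ℕ.* b)
    square-* = ℕSolver.solve-∀

  -- q^(2r) ∣ a² implies q^r ∣ a: q ∣ a, and a = b q gives q^(2r-2) ∣ b².
  square-root-∣ : ∀ r a → q ℕ.^ (2 ℕ.* r) ∣ a ℕ.* a → q ℕ.^ r ∣ a
  square-root-∣ zero    a _ = ℕD.1∣ a
  square-root-∣ (suc r) a q^2r+2∣a² =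
    ≡.subst₂ _∣_ (ℕP.*-comm (q ℕ.^ r) q) (≡.sym a≡bq) (ℕD.*-monoˡ-∣ q (square-root-∣ r b q^2r∣b²))
    where
    q²q^2r∣a² : (q ℕ.* q) ℕ.* q ℕ.^ (2 ℕ.* r) ∣ a ℕ.* a
    q²q^2r∣a² = ≡.subst (_∣ a ℕ.* a) (≡.trans (≡.cong (q ℕ.^_) (ℕP.+-suc (suc r) (r ℕ.+ 0)))
                                               (≡.sym (ℕP.*-assoc q q _))) q^2r+2∣a²
    q∣a : q ∣ a
    q∣a = prime-∣-square a (ℕD.∣-trans (ℕD.∣m⇒∣m*n _ (ℕD.m∣m*n q)) q²q^2r∣a²)
    b : ℕ
    b = ℕD.quotient q∣a
    a≡bq : a ≡ b ℕ.* q
    a≡bq = ℕD._∣_.equality q∣a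
    q^2r∣b² : q ℕ.^ (2 ℕ.* r) ∣ b ℕ.* b
    q^2r∣b² = ℕD.*-cancelˡ-∣ (q ℕ.* q) {{ℕP.m*n≢0 q q}}
      (≡.subst ((q ℕ.* q) ℕ.* q ℕ.^ (2 ℕ.* r) ∣_) (≡.trans (≡.cong₂ ℕ._*_ a≡bq a≡bq) (square-* b q)) q²q^2r∣a²)

  -- q^(2r+1) ∣ a² implies q^(r+1) ∣ a: a = b q^r and q^(2r) q ∣ q^(2r) b² give q ∣ b.
  square-root-∣-odd : ∀ r a → q ℕ.^ suc (2 ℕ.* r) ∣ a ℕ.* a → q ℕ.^ suc r ∣ a
  square-root-∣-odd r a q^2r+1∣a² = ≡.subst (q ℕ.^ suc r ∣_) (≡.sym a≡bq^r) (ℕD.*-monoˡ-∣ (q ℕ.^ r) q∣b)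
    where
    q^r∣a : q ℕ.^ r ∣ a
    q^r∣a = square-root-∣ r a (ℕD.∣-trans (divides q ≡.refl) q^2r+1∣a²)
    b : ℕ
    b = ℕD.quotient q^r∣a
    a≡bq^r : a ≡ b ℕ.* q ℕ.^ r
    a≡bq^r = ℕD._∣_.equality q^r∣a
    q^2rq∣q^2rb² : q ℕ.^ (2 ℕ.* r) ℕ.* q ∣ q ℕ.^ (2 ℕ.* r) ℕ.* (b ℕ.* b)
    q^2rq∣q^2rb² = ≡.subst₂ _∣_ (ℕP.*-comm q _)
      (≡.trans (≡.cong₂ ℕ._*_ a≡bq^r a≡bq^r)
               (≡.trans (square-* b (q ℕ.^ r)) (≡.cong (ℕ._* (b ℕ.* b)) (≡.sym (^-double q r)))))
      q^2r+1∣a²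
    q∣b : q ∣ b
    q∣b = prime-∣-square b (ℕD.*-cancelˡ-∣ (q ℕ.^ (2 ℕ.* r)) {{q^e≢0 (2 ℕ.* r)}} q^2rq∣q^2rb²)

  coprime-cancel : ∀ e a b → ¬ q ∣ a → q ℕ.^ e ∣ a ℕ.* b → q ℕ.^ e ∣ b
  coprime-cancel zero    a b _   _        = ℕD.1∣ b
  coprime-cancel (suc e) a b q∤a q^e+1∣ab =
    ≡.subst₂ _∣_ (ℕP.*-comm (q ℕ.^ e) q) (≡.sym b≡b'q) (ℕD.*-monoˡ-∣ q (coprime-cancel e a b' q∤a q^e∣ab'))
    where
    q∣b : q ∣ b
    q∣b with euclidsLemma a b q-prime (ℕD.∣-trans (ℕD.m∣m*n (q ℕ.^ e)) q^e+1∣ab)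
    ... | inj₁ q∣a = contradiction q∣a q∤a
    ... | inj₂ q∣b = q∣b
    b' : ℕ
    b' = ℕD.quotient q∣b
    b≡b'q : b ≡ b' ℕ.* q
    b≡b'q = ℕD._∣_.equality q∣b
    rearrange : ∀ a b c → a ℕ.* (b ℕ.* c) ≡ c ℕ.* (a ℕ.* b)
    rearrange = ℕSolver.solve-∀
    q^e∣ab' : q ℕ.^ e ∣ a ℕ.* b'
    q^e∣ab' = ℕD.*-cancelˡ-∣ q
      (≡.subst (q ℕ.* q ℕ.^ e ∣_) (≡.trans (≡.cong (a ℕ.*_) b≡b'q) (rearrange a b' q)) q^e+1∣ab)

  ∤ℤ-* : ∀ {x y} → ¬ + q ∣ℤ x → ¬ + q ∣ℤ y → ¬ + q ∣ℤ x ℤ.* y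
  ∤ℤ-* {x} {y} q∤x q∤y q∣xy
    with euclidsLemma ℤ.∣ x ∣ ℤ.∣ y ∣ q-prime (≡.subst (q ∣_) (ℤP.abs-* x y) (∣ℤ⇒∣-abs q∣xy))
  ... | inj₁ q∣x = q∤x (∣-abs⇒∣ℤ q∣x)
  ... | inj₂ q∣y = q∤y (∣-abs⇒∣ℤ q∣y)

  -- If q ∤ B - A, a power of q dividing A B divides A or B: q cannot divide both.
  ∣-product-split : ∀ h A B → ¬ + q ∣ℤ B ℤ.- A → + (q ℕ.^ h) ∣ℤ A ℤ.* B →
    + (q ℕ.^ h) ∣ℤ A ⊎ + (q ℕ.^ h) ∣ℤ B
  ∣-product-split h A B q∤B-A q^h∣AB with q ∣? ℤ.∣ A ∣
  ... | yes q∣A = inj₁ (∣-abs⇒∣ℤ (coprime-cancel h ℤ.∣ B ∣ ℤ.∣ A ∣ q∤B q^h∣BA))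
    where
    q∤B : ¬ q ∣ ℤ.∣ B ∣
    q∤B q∣B = q∤B-A (ℤS.∣m∣n⇒∣m-n (∣-abs⇒∣ℤ {x = B} q∣B) (∣-abs⇒∣ℤ {x = A} q∣A))
    q^h∣BA : q ℕ.^ h ∣ ℤ.∣ B ∣ ℕ.* ℤ.∣ A ∣
    q^h∣BA = ≡.subst (q ℕ.^ h ∣_) (≡.trans (ℤP.abs-* A B) (ℕP.*-comm ℤ.∣ A ∣ ℤ.∣ B ∣)) (∣ℤ⇒∣-abs q^h∣AB)
  ... | no q∤A = inj₂ (∣-abs⇒∣ℤ (coprime-cancel h ℤ.∣ A ∣ ℤ.∣ B ∣ q∤A
                   (≡.subst (q ℕ.^ h ∣_) (ℤP.abs-* A B) (∣ℤ⇒∣-abs q^h∣AB))))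

  -- Every integer x with q ∤ x is invertible modulo q.  By Bézout for the coprime pair
  -- q, a = x mod q, some y satisfies y a ≡ 1, hence y x ≡ 1 (mod q).
  inverse-mod-q : ∀ x → ¬ + q ∣ℤ x → ∃ λ y → + q ∣ℤ (y ℤ.* x) ℤ.- + 1
  inverse-mod-q x q∤x = from-residue (inverse-of-a bezout)
    where
    a : ℕ
    a = x %ℕ q
    a≢0 : a ≢ 0
    a≢0 a≡0 = q∤x (%ℕ≡0⇒∣ q x a≡0)
    bezout : Bézout.Identity 1 q a
    bezout = coprime-Bézout (prime⇒coprime q-prime {{ℕ.≢-nonZero a≢0}} (ℤDM.n%ℕd<d x q))
    embed : ∀ u v w → 1 ℕ.+ u ℕ.* v ≡ w → + 1 ℤ.+ + u ℤ.* + v ≡ + w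
    embed u v w eq = ≡.trans (≡.cong (λ z → + 1 ℤ.+ z) (≡.sym (ℤP.pos-* u v))) (≡.cong +_ eq)
    negated : ∀ V A → (ℤ.- V) ℤ.* A ℤ.- + 1 ≡ ℤ.- (+ 1 ℤ.+ V ℤ.* A)
    negated = solve-∀
    cancel-one : ∀ W → (+ 1 ℤ.+ W) ℤ.- + 1 ≡ W
    cancel-one = solve-∀
    inverse-of-a : Bézout.Identity 1 q a → ∃ λ y → + q ∣ℤ (y ℤ.* + a) ℤ.- + 1
    inverse-of-a (Bézout.+- u v 1+va≡uq) = ℤ.- + v , ℤS.divides (ℤ.- + u)
      (≡.trans (negated (+ v) (+ a))
        (≡.trans (≡.cong ℤ.-_ (≡.trans (embed v a _ 1+va≡uq) (ℤP.pos-* u q))) (ℤP.neg-distribˡ-* (+ u) (+ q))))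
    inverse-of-a (Bézout.-+ u v 1+uq≡va) = + v , ℤS.divides (+ u)
      (≡.trans (≡.cong (ℤ._- + 1) (≡.sym (≡.trans (embed u q _ 1+uq≡va) (ℤP.pos-* v a))))
               (cancel-one (+ u ℤ.* + q)))
    via-residue : ∀ y x a → (y ℤ.* x) ℤ.- + 1 ≡ y ℤ.* (x ℤ.- a) ℤ.+ ((y ℤ.* a) ℤ.- + 1)
    via-residue = solve-∀
    from-residue : (∃ λ y → + q ∣ℤ (y ℤ.* + a) ℤ.- + 1) → ∃ λ y → + q ∣ℤ (y ℤ.* x) ℤ.- + 1
    from-residue (y , ya≡1) = y , ≡.subst (+ q ∣ℤ_) (≡.sym (via-residue y x (+ a)))
                                   (ℤS.∣m∣n⇒∣m+n (ℤS.∣n⇒∣m*n y (∣-residue q x)) ya≡1)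

module Roots (q : ℕ) (q-prime : Prime q) (q≢2 : q ≢ 2) (k : ℕ) (n : ℤ) where
  open Exponents
  open PrimePowers q q-prime
  open Congruences

  N : ℕ
  N = q ℕ.^ (2 ℕ.* k)

  Root : ℕ → Set
  Root a = + N ∣ℤ (+ a ℤ.* + a) ℤ.- (+ 4 ℤ.* n)

  q^r·q^j≡N : ∀ r j → r ℕ.+ j ≡ 2 ℕ.* k → q ℕ.^ r ℕ.* q ℕ.^ j ≡ N
  q^r·q^j≡N r j r+j≡2k = ≡.trans (≡.sym (^-+ q r j)) (≡.cong (q ℕ.^_) r+j≡2k)

  -- If q^(2r) ∣ n with r ≤ k, then q^(2r) ∣ a² for every root a, hence q^r ∣ a.
  root-divisible : ∀ r → r ≤ k → q ℕ.^ (2 ℕ.* r) ∣ ℤ.∣ n ∣ → ∀ a → Root a → q ℕ.^ r ∣ a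
  root-divisible r r≤k q^2r∣n a a-root =
    square-root-∣ r a (≡.subst (q ℕ.^ (2 ℕ.* r) ∣_) (ℤP.abs-* (+ a) (+ a)) (∣ℤ⇒∣-abs q^2r∣a²))
    where
    q^2r∣a² : + (q ℕ.^ (2 ℕ.* r)) ∣ℤ + a ℤ.* + a
    q^2r∣a² = ∣-sub⇒∣ˡ (ℤS.∣-trans (∣⇒∣ℤ (^-mono-∣ q (ℕP.*-monoʳ-≤ 2 r≤k))) a-root)
                       (ℤS.∣n⇒∣m*n (+ 4) (∣-abs⇒∣ℤ q^2r∣n))

  -- For r + j = 2k, r ≤ j and q^r ∣ u, the number c q^j + u is a root iff u is: the
  -- difference of the squares is (c q^j + 2u) · c q^j, divisible by q^r · q^j = N.
  root-shift : ∀ r j → r ℕ.+ j ≡ 2 ℕ.* k → r ≤ j → ∀ c u → q ℕ.^ r ∣ u →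
    (Root (c ℕ.* q ℕ.^ j ℕ.+ u) → Root u) × (Root u → Root (c ℕ.* q ℕ.^ j ℕ.+ u))
  root-shift r j r+j≡2k r≤j c u q^r∣u = (λ a-root → ∣-sub⇒∣ʳ N∣difference a-root)
                                      , (λ u-root → ∣-sub⇒∣ˡ N∣difference u-root)
    where
    X : ℤ
    X = + (c ℕ.* q ℕ.^ j)
    difference-of-squares : ∀ X U F → (((X ℤ.+ U) ℤ.* (X ℤ.+ U)) ℤ.- F) ℤ.- ((U ℤ.* U) ℤ.- F)
                                    ≡ (X ℤ.+ + 2 ℤ.* U) ℤ.* X
    difference-of-squares = solve-∀
    q^r∣X+2u : + (q ℕ.^ r) ∣ℤ X ℤ.+ + 2 ℤ.* + u
    q^r∣X+2u = ℤS.∣m∣n⇒∣m+n (∣⇒∣ℤ (ℕD.∣-trans (^-mono-∣ q r≤j) (ℕD.n∣m*n c)))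
                            (ℤS.∣n⇒∣m*n (+ 2) (∣⇒∣ℤ q^r∣u))
    N∣difference : + N ∣ℤ ((+ (c ℕ.* q ℕ.^ j ℕ.+ u) ℤ.* + (c ℕ.* q ℕ.^ j ℕ.+ u)) ℤ.- (+ 4 ℤ.* n))
                          ℤ.- ((+ u ℤ.* + u) ℤ.- (+ 4 ℤ.* n))
    N∣difference = ≡.subst₂ _∣ℤ_ (≡.cong +_ (q^r·q^j≡N r j r+j≡2k))
      (≡.sym (≡.trans (≡.cong (λ A → ((A ℤ.* A) ℤ.- (+ 4 ℤ.* n)) ℤ.- ((+ u ℤ.* + u) ℤ.- (+ 4 ℤ.* n)))
                              (ℤP.pos-+ (c ℕ.* q ℕ.^ j) u))
                      (difference-of-squares X (+ u) (+ 4 ℤ.* n))))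
      (∣ℤ-* q^r∣X+2u (∣⇒∣ℤ (ℕD.n∣m*n c)))

  -- If x² ≡ 4n (mod N) and q^m ∣ n exactly with m < 2k, then m is even: for m = 2r + 1,
  -- q^(2r+1) ∣ x², so q^(r+1) ∣ x, so q^(2r+2) ∣ 4n and (q being odd) q^(2r+2) ∣ n.
  even-valuation : ∀ m x → + N ∣ℤ (x ℤ.* x) ℤ.- (+ 4 ℤ.* n) → m < 2 ℕ.* k →
    q ℕ.^ m ∣ ℤ.∣ n ∣ → ¬ q ℕ.^ suc m ∣ ℤ.∣ n ∣ → ∃ λ r → m ≡ 2 ℕ.* r
  even-valuation m x N∣x²-4n m<2k q^m∣n q^m+1∤n with even-or-odd m
  ... | r , inj₁ m≡2r  = r , m≡2r
  ... | r , inj₂ ≡.refl = contradiction q^2r+2∣n q^m+1∤n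
    where
    q^2r+1∣x² : + (q ℕ.^ suc (2 ℕ.* r)) ∣ℤ x ℤ.* x
    q^2r+1∣x² = ∣-sub⇒∣ˡ (ℤS.∣-trans (∣⇒∣ℤ (^-mono-∣ q (ℕP.<⇒≤ m<2k))) N∣x²-4n)
                         (ℤS.∣n⇒∣m*n (+ 4) (∣-abs⇒∣ℤ q^m∣n))
    q^r+1∣x : + (q ℕ.^ suc r) ∣ℤ x
    q^r+1∣x = ∣-abs⇒∣ℤ (square-root-∣-odd r ℤ.∣ x ∣
                (≡.subst (q ℕ.^ suc (2 ℕ.* r) ∣_) (ℤP.abs-* x x) (∣ℤ⇒∣-abs q^2r+1∣x²)))
    q^2r+2≡q^[r+1]² : q ℕ.^ suc (suc (2 ℕ.* r)) ≡ q ℕ.^ suc r ℕ.* q ℕ.^ suc r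
    q^2r+2≡q^[r+1]² = ≡.trans (≡.cong (λ e → q ℕ.^ suc e) (≡.sym (ℕP.+-suc r (r ℕ.+ 0)))) (^-double q (suc r))
    q^2r+2∣4n : + (q ℕ.^ suc (suc (2 ℕ.* r))) ∣ℤ + 4 ℤ.* n
    q^2r+2∣4n = ∣-sub⇒∣ʳ (ℤS.∣-trans (∣⇒∣ℤ (^-mono-∣ q m<2k)) N∣x²-4n)
                  (≡.subst (λ d → + d ∣ℤ x ℤ.* x) (≡.sym q^2r+2≡q^[r+1]²) (∣ℤ-* q^r+1∣x q^r+1∣x))
    q^2r+2∣n : q ℕ.^ suc (suc (2 ℕ.* r)) ∣ ℤ.∣ n ∣
    q^2r+2∣n = coprime-cancel (suc (suc (2 ℕ.* r))) 4 ℤ.∣ n ∣ (odd-prime∤4 q≢2)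
                 (≡.subst (q ℕ.^ suc (suc (2 ℕ.* r)) ∣_) (ℤP.abs-* (+ 4) n) (∣ℤ⇒∣-abs q^2r+2∣4n))

  -- The case n = q^(2r) t with q ∤ t, 2r < 2k, and s² ≡ t (mod q^h), h = 2k - 2r.  Modulo
  -- q^j, j = r + h = 2k - r, the roots are exactly the residues u₁, u₂ of ±b, b = 2 q^r s,
  -- and u₁ ≠ u₂.
  module TwoRoots (r : ℕ) (t s : ℤ) (2r<2k : 2 ℕ.* r < 2 ℕ.* k)
                  (n≡q^2rt : n ≡ + (q ℕ.^ (2 ℕ.* r)) ℤ.* t) (q^2r+1∤n : ¬ q ℕ.^ suc (2 ℕ.* r) ∣ ℤ.∣ n ∣)
                  (s²≡t : q ℕ.^ (2 ℕ.* k ℕ.∸ 2 ℕ.* r) ∣ ℤ.∣ (s ℤ.* s) ℤ.- t ∣) where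
    h : ℕ
    h = 2 ℕ.* k ℕ.∸ 2 ℕ.* r
    j : ℕ
    j = r ℕ.+ h
    Qʳ : ℤ
    Qʳ = + (q ℕ.^ r)
    b : ℤ
    b = + 2 ℤ.* (Qʳ ℤ.* s)

    instance
      q^j≢0 : NonZero (q ℕ.^ j)
      q^j≢0 = q^e≢0 j
      Qʳ≢0 : ℤ.NonZero Qʳ
      Qʳ≢0 = q^e≢0 r

    2r+h≡2k : 2 ℕ.* r ℕ.+ h ≡ 2 ℕ.* k
    2r+h≡2k = ℕP.m+[n∸m]≡n (ℕP.<⇒≤ 2r<2k)
    r+j≡2k : r ℕ.+ j ≡ 2 ℕ.* k
    r+j≡2k = ≡.trans (≡.sym (ℕP.+-assoc r r h))
               (≡.trans (≡.cong (λ x → r ℕ.+ x ℕ.+ h) (≡.sym (ℕP.+-identityʳ r))) 2r+h≡2k)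
    r≤k : r ≤ k
    r≤k = ℕP.<⇒≤ (ℕP.*-cancelˡ-< 2 r k 2r<2k)
    r≤j : r ≤ j
    r≤j = ℕP.m≤m+n r h
    1≤h : 1 ≤ h
    1≤h = ℕP.m<n⇒0<n∸m 2r<2k
    q^2r·q^h≡N : q ℕ.^ (2 ℕ.* r) ℕ.* q ℕ.^ h ≡ N
    q^2r·q^h≡N = q^r·q^j≡N (2 ℕ.* r) h 2r+h≡2k
    q^2r≡Qʳ² : + (q ℕ.^ (2 ℕ.* r)) ≡ Qʳ ℤ.* Qʳ
    q^2r≡Qʳ² = ≡.trans (≡.cong +_ (^-double q r)) (ℤP.pos-* (q ℕ.^ r) (q ℕ.^ r))
    q^2r∣n : q ℕ.^ (2 ℕ.* r) ∣ ℤ.∣ n ∣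
    q^2r∣n = ∣ℤ⇒∣-abs (≡.subst (+ (q ℕ.^ (2 ℕ.* r)) ∣ℤ_) (≡.sym n≡q^2rt) (ℤS.∣m⇒∣m*n t ℤS.∣-refl))

    -- q ∤ s: otherwise q divides s² and s² - t, hence t, and then q^(2r+1) ∣ n.
    q∤s : ¬ + q ∣ℤ s
    q∤s q∣s = q^2r+1∤n (≡.subst₂ _∣_ (ℕP.*-comm (q ℕ.^ (2 ℕ.* r)) q) (≡.sym |n|≡q^2r|t|)
                         (ℕD.*-monoʳ-∣ (q ℕ.^ (2 ℕ.* r)) (∣ℤ⇒∣-abs q∣t)))
      where
      |n|≡q^2r|t| : ℤ.∣ n ∣ ≡ q ℕ.^ (2 ℕ.* r) ℕ.* ℤ.∣ t ∣
      |n|≡q^2r|t| = ≡.trans (≡.cong ℤ.∣_∣ n≡q^2rt) (ℤP.abs-* (+ (q ℕ.^ (2 ℕ.* r))) t)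
      q∣t : + q ∣ℤ t
      q∣t = ∣-sub⇒∣ʳ (ℤS.∣-trans (∣⇒∣ℤ (q∣q^e 1≤h)) (∣-abs⇒∣ℤ s²≡t)) (ℤS.∣m⇒∣m*n s q∣s)

    q∤4s : ¬ + q ∣ℤ + 4 ℤ.* s
    q∤4s = ∤ℤ-* {+ 4} {s} (λ q∣4 → odd-prime∤4 q≢2 (∣ℤ⇒∣-abs q∣4)) q∤s

    -- b² - 4n = 4 q^(2r) (s² - t) is divisible by q^(2r) q^h = N.
    b²≡4n : + N ∣ℤ (b ℤ.* b) ℤ.- (+ 4 ℤ.* n)
    b²≡4n = ≡.subst₂ _∣ℤ_ (≡.cong +_ q^2r·q^h≡N) (≡.sym b²-4n)
              (∣ℤ-* (ℤS.∣n⇒∣m*n (+ 4) (ℤS.∣-reflexive q^2r≡Qʳ²)) (∣-abs⇒∣ℤ s²≡t))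
      where
      factor : ∀ Q s t → ((+ 2 ℤ.* (Q ℤ.* s)) ℤ.* (+ 2 ℤ.* (Q ℤ.* s))) ℤ.- (+ 4 ℤ.* ((Q ℤ.* Q) ℤ.* t))
                         ≡ (+ 4 ℤ.* (Q ℤ.* Q)) ℤ.* ((s ℤ.* s) ℤ.- t)
      factor = solve-∀
      b²-4n : (b ℤ.* b) ℤ.- (+ 4 ℤ.* n) ≡ (+ 4 ℤ.* (Qʳ ℤ.* Qʳ)) ℤ.* ((s ℤ.* s) ℤ.- t)
      b²-4n = ≡.trans (≡.cong (λ m → (b ℤ.* b) ℤ.- (+ 4 ℤ.* m)) (≡.trans n≡q^2rt (≡.cong (ℤ._* t) q^2r≡Qʳ²)))
                      (factor Qʳ s t)

    q^r∣b : + (q ℕ.^ r) ∣ℤ b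
    q^r∣b = ℤS.∣n⇒∣m*n (+ 2) (ℤS.∣m⇒∣m*n s ℤS.∣-refl)

    -- Any x ≡ b' (mod q^j), where b' = ±b, is a root: x² - 4n = (x + b')(x - b') + (b² - 4n)
    -- with q^r ∣ x + b' = (x - b') + 2b' and q^j ∣ x - b'.
    near-±b-is-root : ∀ x b' → + (q ℕ.^ r) ∣ℤ b' → b' ℤ.* b' ≡ b ℤ.* b →
      + (q ℕ.^ j) ∣ℤ x ℤ.- b' → + N ∣ℤ (x ℤ.* x) ℤ.- (+ 4 ℤ.* n)
    near-±b-is-root x b' q^r∣b' b'²≡b² q^j∣x-b' =
      ≡.subst (+ N ∣ℤ_) (≡.sym (split x b' (+ 4 ℤ.* n)))
        (ℤS.∣m∣n⇒∣m+n (≡.subst (_∣ℤ (x ℤ.+ b') ℤ.* (x ℤ.- b')) (≡.cong +_ (q^r·q^j≡N r j r+j≡2k))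
                                (∣ℤ-* q^r∣x+b' q^j∣x-b'))
                      (≡.subst (λ y → + N ∣ℤ y ℤ.- (+ 4 ℤ.* n)) (≡.sym b'²≡b²) b²≡4n))
      where
      split : ∀ x b F → (x ℤ.* x) ℤ.- F ≡ ((x ℤ.+ b) ℤ.* (x ℤ.- b)) ℤ.+ ((b ℤ.* b) ℤ.- F)
      split = solve-∀
      shift : ∀ x b → x ℤ.+ b ≡ (x ℤ.- b) ℤ.+ + 2 ℤ.* b
      shift = solve-∀
      q^r∣x+b' : + (q ℕ.^ r) ∣ℤ x ℤ.+ b'
      q^r∣x+b' = ≡.subst (+ (q ℕ.^ r) ∣ℤ_) (≡.sym (shift x b'))
                   (ℤS.∣m∣n⇒∣m+n (ℤS.∣-trans (∣⇒∣ℤ (^-mono-∣ q r≤j)) q^j∣x-b') (ℤS.∣n⇒∣m*n (+ 2) q^r∣b'))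

    u₁ u₂ : ℕ
    u₁ = b %ℕ q ℕ.^ j
    u₂ = (ℤ.- b) %ℕ q ℕ.^ j

    u₁<q^j : u₁ < q ℕ.^ j
    u₁<q^j = ℤDM.n%ℕd<d b (q ℕ.^ j)
    u₂<q^j : u₂ < q ℕ.^ j
    u₂<q^j = ℤDM.n%ℕd<d (ℤ.- b) (q ℕ.^ j)

    u₁≡b : + (q ℕ.^ j) ∣ℤ + u₁ ℤ.- b
    u₁≡b = ∣-sub-sym {X = b} (∣-residue (q ℕ.^ j) b)
    u₂≡-b : + (q ℕ.^ j) ∣ℤ + u₂ ℤ.- (ℤ.- b)
    u₂≡-b = ∣-sub-sym {X = ℤ.- b} (∣-residue (q ℕ.^ j) (ℤ.- b))

    u₁-root : Root u₁
    u₁-root = near-±b-is-root (+ u₁) b q^r∣b ≡.refl u₁≡b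
    u₂-root : Root u₂
    u₂-root = near-±b-is-root (+ u₂) (ℤ.- b) (ℤS.∣m⇒∣-m q^r∣b) (square-neg b) u₂≡-b
      where
      square-neg : ∀ b → (ℤ.- b) ℤ.* (ℤ.- b) ≡ b ℤ.* b
      square-neg = solve-∀

    q^j≡Qʳ·q^h : + (q ℕ.^ j) ≡ Qʳ ℤ.* + (q ℕ.^ h)
    q^j≡Qʳ·q^h = ≡.trans (≡.cong +_ (^-+ q r h)) (ℤP.pos-* (q ℕ.^ r) (q ℕ.^ h))

    cancel-q^r : ∀ {X} → + (q ℕ.^ j) ∣ℤ Qʳ ℤ.* X → + (q ℕ.^ h) ∣ℤ X
    cancel-q^r {X} q^j∣Qʳ·X = ℤS.*-cancelˡ-∣ Qʳ (≡.subst (_∣ℤ Qʳ ℤ.* X) q^j≡Qʳ·q^h q^j∣Qʳ·X)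

    scale-q^r : ∀ {X} → + (q ℕ.^ h) ∣ℤ X → + (q ℕ.^ j) ∣ℤ Qʳ ℤ.* X
    scale-q^r {X} q^h∣X = ≡.subst (_∣ℤ Qʳ ℤ.* X) (≡.sym q^j≡Qʳ·q^h) (ℤS.*-monoʳ-∣ Qʳ q^h∣X)

    -- u₁ ≠ u₂: otherwise q^j ∣ b - (-b) = q^r · 4s, so q^h ∣ 4s and q ∣ 4s.
    u₁≢u₂ : u₁ ≢ u₂
    u₁≢u₂ u₁≡u₂ = q∤4s (ℤS.∣-trans (∣⇒∣ℤ (q∣q^e 1≤h)) (cancel-q^r q^j∣Qʳ·4s))
      where
      difference : ∀ Q s U → (U ℤ.- (ℤ.- (+ 2 ℤ.* (Q ℤ.* s)))) ℤ.- (U ℤ.- (+ 2 ℤ.* (Q ℤ.* s)))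
                             ≡ Q ℤ.* (+ 4 ℤ.* s)
      difference = solve-∀
      q^j∣Qʳ·4s : + (q ℕ.^ j) ∣ℤ Qʳ ℤ.* (+ 4 ℤ.* s)
      q^j∣Qʳ·4s = ≡.subst (+ (q ℕ.^ j) ∣ℤ_) (difference Qʳ s (+ u₂))
                    (ℤS.∣m∣n⇒∣m-n u₂≡-b (≡.subst (λ u → + (q ℕ.^ j) ∣ℤ + u ℤ.- b) u₁≡u₂ u₁≡b))

    -- Write u = W q^r; then N ∣ u² - b² = q^(2r)(W - 2s)(W + 2s),
    -- so q^h ∣ (W - 2s)(W + 2s).  As q ∤ (W + 2s) - (W - 2s) = 4s, q^h divides one factor,
    -- i.e. u ≡ b or u ≡ -b modulo q^j.
    root-cases : ∀ u → u < q ℕ.^ j → Root u → u ≡ u₁ ⊎ u ≡ u₂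
    root-cases u u<q^j u-root = Sum.map near-b near-−b (∣-product-split h (W ℤ.- 2s) (W ℤ.+ 2s) q∤gap q^h∣product)
      where
      q^r∣u : q ℕ.^ r ∣ u
      q^r∣u = root-divisible r r≤k q^2r∣n u u-root
      W 2s : ℤ
      W = + ℕD.quotient q^r∣u
      2s = + 2 ℤ.* s
      u≡WQʳ : + u ≡ W ℤ.* Qʳ
      u≡WQʳ = ≡.trans (≡.cong +_ (ℕD._∣_.equality q^r∣u)) (ℤP.pos-* (ℕD.quotient q^r∣u) (q ℕ.^ r))
      squares : ∀ W Q s F → (((W ℤ.* Q) ℤ.* (W ℤ.* Q)) ℤ.- F) ℤ.- (((+ 2 ℤ.* (Q ℤ.* s)) ℤ.* (+ 2 ℤ.* (Q ℤ.* s))) ℤ.- F)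
                            ≡ (Q ℤ.* Q) ℤ.* ((W ℤ.- + 2 ℤ.* s) ℤ.* (W ℤ.+ + 2 ℤ.* s))
      squares = solve-∀
      minus : ∀ W Q s → (W ℤ.* Q) ℤ.- (+ 2 ℤ.* (Q ℤ.* s)) ≡ Q ℤ.* (W ℤ.- + 2 ℤ.* s)
      minus = solve-∀
      plus : ∀ W Q s → (W ℤ.* Q) ℤ.- (ℤ.- (+ 2 ℤ.* (Q ℤ.* s))) ≡ Q ℤ.* (W ℤ.+ + 2 ℤ.* s)
      plus = solve-∀
      gap : ∀ W s → (W ℤ.+ + 2 ℤ.* s) ℤ.- (W ℤ.- + 2 ℤ.* s) ≡ + 4 ℤ.* s
      gap = solve-∀
      q∤gap : ¬ + q ∣ℤ (W ℤ.+ 2s) ℤ.- (W ℤ.- 2s)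
      q∤gap = ≡.subst (λ x → ¬ + q ∣ℤ x) (≡.sym (gap W s)) q∤4s
      u²-b² : ((+ u ℤ.* + u) ℤ.- (+ 4 ℤ.* n)) ℤ.- ((b ℤ.* b) ℤ.- (+ 4 ℤ.* n))
              ≡ + (q ℕ.^ (2 ℕ.* r)) ℤ.* ((W ℤ.- 2s) ℤ.* (W ℤ.+ 2s))
      u²-b² = ≡.trans (≡.cong (λ x → ((x ℤ.* x) ℤ.- (+ 4 ℤ.* n)) ℤ.- ((b ℤ.* b) ℤ.- (+ 4 ℤ.* n))) u≡WQʳ)
                (≡.trans (squares W Qʳ s (+ 4 ℤ.* n)) (≡.cong (ℤ._* ((W ℤ.- 2s) ℤ.* (W ℤ.+ 2s))) (≡.sym q^2r≡Qʳ²)))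
      q^h∣product : + (q ℕ.^ h) ∣ℤ (W ℤ.- 2s) ℤ.* (W ℤ.+ 2s)
      q^h∣product = ℤS.*-cancelˡ-∣ (+ (q ℕ.^ (2 ℕ.* r))) {{q^e≢0 (2 ℕ.* r)}}
        (≡.subst₂ _∣ℤ_ (≡.trans (≡.cong +_ (≡.sym q^2r·q^h≡N)) (ℤP.pos-* (q ℕ.^ (2 ℕ.* r)) (q ℕ.^ h))) u²-b²
                  (ℤS.∣m∣n⇒∣m-n u-root b²≡4n))
      near-b : + (q ℕ.^ h) ∣ℤ W ℤ.- 2s → u ≡ u₁
      near-b q^h∣W-2s = %ℕ-unique (q ℕ.^ j) b u<q^j
        (≡.subst (λ x → + (q ℕ.^ j) ∣ℤ x ℤ.- b) (≡.sym u≡WQʳ)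
          (≡.subst (+ (q ℕ.^ j) ∣ℤ_) (≡.sym (minus W Qʳ s)) (scale-q^r q^h∣W-2s)))
      near-−b : + (q ℕ.^ h) ∣ℤ W ℤ.+ 2s → u ≡ u₂
      near-−b q^h∣W+2s = %ℕ-unique (q ℕ.^ j) (ℤ.- b) u<q^j
        (≡.subst (λ x → + (q ℕ.^ j) ∣ℤ x ℤ.- (ℤ.- b)) (≡.sym u≡WQʳ)
          (≡.subst (+ (q ℕ.^ j) ∣ℤ_) (≡.sym (plus W Qʳ s)) (scale-q^r q^h∣W+2s)))

module Kloosterman {c ℓ} (R : CommutativeRing c ℓ) (p : ℕ) (q-prime : Prime (suc p)) (q≢2 : suc p ≢ 2)
                   (ξ n : ℤ) (k : ℕ) (ζ : CommutativeRing.Carrier R)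
                   (Φζ≈0 : InRing.CycloRoot R (suc p) (2 ℕ.* k) ζ) where
  open CommutativeRing R
  open InRing R
  open FiniteSums R
  open Powers R
  open Congruences
  open Exponents
  open PrimePowers (suc p) q-prime
  open Roots (suc p) q-prime q≢2 k n
  open import Relation.Binary.Reasoning.Setoid setoid

  q : ℕ
  q = suc p

  instance
    N≢0 : NonZero N
    N≢0 = q^e≢0 (2 ℕ.* k)

  -- The additive character x ↦ e(x/N), represented by ζ^(x mod N).
  e : ℤ → Carrier
  e x = pow ζ (x %ℕ N)

  -- e is well defined and a character of ℤ/N, because ζ^N = 1.
  ζᴺ≈1 : pow ζ N ≈ 1#
  ζᴺ≈1 = cycloRoot⇒pow≈1 q (2 ℕ.* k) ζ Φζ≈0

  pow≈e : ∀ m x → + N ∣ℤ + m ℤ.- x → pow ζ m ≈ e x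
  pow≈e m x N∣m-x = trans (pow-mod ζ N ζᴺ≈1 m) (reflexive (≡.cong (pow ζ) (%ℕ-cong N (+ m) x N∣m-x)))

  e-cong : ∀ x y → + N ∣ℤ x ℤ.- y → e x ≈ e y
  e-cong x y N∣x-y = reflexive (≡.cong (pow ζ) (%ℕ-cong N x y N∣x-y))

  e-1 : ∀ x → + N ∣ℤ x → e x ≈ 1#
  e-1 x N∣x = reflexive (≡.cong (pow ζ) (∣⇒%ℕ≡0 N x N∣x))

  e-+ : ∀ x y → e (x ℤ.+ y) ≈ e x * e y
  e-+ x y = trans (sym (pow≈e (rx ℕ.+ ry) (x ℤ.+ y) N∣rx+ry-x-y)) (pow-+ ζ rx ry)
    where
    rx ry : ℕ
    rx = x %ℕ N
    ry = y %ℕ N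
    regroup : ∀ a b x y → (a ℤ.+ b) ℤ.- (x ℤ.+ y) ≡ ℤ.- ((x ℤ.- a) ℤ.+ (y ℤ.- b))
    regroup = solve-∀
    N∣rx+ry-x-y : + N ∣ℤ + (rx ℕ.+ ry) ℤ.- (x ℤ.+ y)
    N∣rx+ry-x-y = ≡.subst (λ z → + N ∣ℤ z ℤ.- (x ℤ.+ y)) (≡.sym (ℤP.pos-+ rx ry))
      (≡.subst (+ N ∣ℤ_) (≡.sym (regroup (+ rx) (+ ry) x y))
        (ℤS.∣m⇒∣-m (ℤS.∣m∣n⇒∣m+n (∣-residue N x) (∣-residue N y))))

  e-+ξ : ∀ a b → e (+ (a ℕ.+ b) ℤ.* ξ) ≈ e (+ a ℤ.* ξ) * e (+ b ℤ.* ξ)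
  e-+ξ a b = trans (reflexive (≡.cong e (≡.trans (≡.cong (ℤ._* ξ) (ℤP.pos-+ a b)) (ℤP.*-distribʳ-+ ξ (+ a) (+ b)))))
                   (e-+ (+ a ℤ.* ξ) (+ b ℤ.* ξ))

  e-period : ∀ r j → r ℕ.+ j ≡ 2 ℕ.* k → q ℕ.^ r ∣ ℤ.∣ ξ ∣ →
    ∀ x y → + (q ℕ.^ j) ∣ℤ x ℤ.- y → e (x ℤ.* ξ) ≈ e (y ℤ.* ξ)
  e-period r j r+j≡2k q^r∣ξ x y q^j∣x-y = e-cong (x ℤ.* ξ) (y ℤ.* ξ)
      (≡.subst₂ _∣ℤ_ (≡.cong +_ (≡.trans (ℕP.*-comm (q ℕ.^ j) (q ℕ.^ r)) (q^r·q^j≡N r j r+j≡2k)))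
                (distrib-ξ x y ξ) (∣ℤ-* q^j∣x-y (∣-abs⇒∣ℤ q^r∣ξ)))
    where
    distrib-ξ : ∀ x y z → (x ℤ.- y) ℤ.* z ≡ x ℤ.* z ℤ.- y ℤ.* z
    distrib-ξ = solve-∀

  -- The summand T of Kl = Σ_{a<N} T a, read off from the definition of Kl (where it is local).
  Kl-as-sum : Σ (ℕ → Carrier) λ T → Kl q k ζ ξ n ≡ Σ< N T
  Kl-as-sum = _ , ≡.refl

  T : ℕ → Carrier
  T = proj₁ Kl-as-sum

  T-root : ∀ a → Root a → T a ≈ e (+ a ℤ.* ξ)
  T-root a a-root with res q (2 ℕ.* k) ((+ a ℤ.* + a) ℤ.- (+ 4 ℤ.* n)) ℕ.≟ 0
  ... | yes _     = refl
  ... | no  res≢0 = contradiction (∣⇒%ℕ≡0 N _ a-root) res≢0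

  T-nonroot : ∀ a → ¬ Root a → T a ≈ 0#
  T-nonroot a a-nonroot with res q (2 ℕ.* k) ((+ a ℤ.* + a) ℤ.- (+ 4 ℤ.* n)) ℕ.≟ 0
  ... | yes res≡0 = contradiction (%ℕ≡0⇒∣ N _ res≡0) a-nonroot
  ... | no  _     = refl

  K : Carrier
  K = Kl q k ζ ξ n

  S : ℕ → ℕ → Carrier
  S r j = Σ< (q ℕ.^ r) (λ c → e (+ (c ℕ.* q ℕ.^ j) ℤ.* ξ))

  -- If r + j = 2k, r ≤ j and every root is divisible by q^r, then K = S r j · Σ_{u<q^j} T u:
  -- write a = c q^j + u; then a is a root iff u is, and e(aξ) = e(c q^j ξ) e(uξ).
  Kl-factor : ∀ r j → r ℕ.+ j ≡ 2 ℕ.* k → r ≤ j → (∀ a → Root a → q ℕ.^ r ∣ a) →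
    K ≈ S r j * Σ< (q ℕ.^ j) T
  Kl-factor r j r+j≡2k r≤j roots-divisible = begin
    K                          ≡⟨ proj₂ Kl-as-sum ⟩
    Σ< N T                     ≡⟨ ≡.cong (λ M → Σ< M T) (≡.sym (q^r·q^j≡N r j r+j≡2k)) ⟩
    Σ< (q ℕ.^ r ℕ.* q ℕ.^ j) T ≈⟨ Σ<-factor (q ℕ.^ r) (q ℕ.^ j) T _ T split ⟩
    S r j * Σ< (q ℕ.^ j) T     ∎
    where
    split : ∀ c u → c < q ℕ.^ r → u < q ℕ.^ j →
      T (c ℕ.* q ℕ.^ j ℕ.+ u) ≈ e (+ (c ℕ.* q ℕ.^ j) ℤ.* ξ) * T u
    split c u _ _ with + N ℤS.∣? (+ u ℤ.* + u) ℤ.- (+ 4 ℤ.* n)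
    ... | yes u-root = begin
      T (c ℕ.* q ℕ.^ j ℕ.+ u)                      ≈⟨ T-root (c ℕ.* q ℕ.^ j ℕ.+ u) a-root ⟩
      e (+ (c ℕ.* q ℕ.^ j ℕ.+ u) ℤ.* ξ)            ≈⟨ e-+ξ (c ℕ.* q ℕ.^ j) u ⟩
      e (+ (c ℕ.* q ℕ.^ j) ℤ.* ξ) * e (+ u ℤ.* ξ) ≈⟨ *-congˡ (T-root u u-root) ⟨
      e (+ (c ℕ.* q ℕ.^ j) ℤ.* ξ) * T u           ∎
      where
      a-root : Root (c ℕ.* q ℕ.^ j ℕ.+ u)
      a-root = proj₂ (root-shift r j r+j≡2k r≤j c u (roots-divisible u u-root)) u-root
    ... | no u-nonroot = begin
      T (c ℕ.* q ℕ.^ j ℕ.+ u)           ≈⟨ T-nonroot (c ℕ.* q ℕ.^ j ℕ.+ u) a-nonroot ⟩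
      0#                                ≈⟨ zeroʳ _ ⟨
      e (+ (c ℕ.* q ℕ.^ j) ℤ.* ξ) * 0#  ≈⟨ *-congˡ (T-nonroot u u-nonroot) ⟨
      e (+ (c ℕ.* q ℕ.^ j) ℤ.* ξ) * T u ∎
      where
      -- A root c q^j + u would be divisible by q^r, hence so would u, making u a root.
      a-nonroot : ¬ Root (c ℕ.* q ℕ.^ j ℕ.+ u)
      a-nonroot a-root = u-nonroot (proj₁ (root-shift r j r+j≡2k r≤j c u q^r∣u) a-root)
        where
        q^r∣u : q ℕ.^ r ∣ u
        q^r∣u = ℕD.∣m+n∣m⇒∣n (roots-divisible (c ℕ.* q ℕ.^ j ℕ.+ u) a-root) (ℕD.∣-trans (^-mono-∣ q r≤j) (ℕD.n∣m*n c))

  -- If q^r ∣ ξ and r + j = 2k, every term of S r j is e(multiple of N) = 1.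
  S-full : ∀ r j → r ℕ.+ j ≡ 2 ℕ.* k → q ℕ.^ r ∣ ℤ.∣ ξ ∣ → S r j ≈ ι (q ℕ.^ r)
  S-full r j r+j≡2k q^r∣ξ = Σ<-one (q ℕ.^ r) λ c _ → e-1 (+ (c ℕ.* q ℕ.^ j) ℤ.* ξ)
    (≡.subst (_∣ℤ + (c ℕ.* q ℕ.^ j) ℤ.* ξ) (≡.cong +_ q^j·q^r≡N) (∣ℤ-* (∣⇒∣ℤ (ℕD.n∣m*n c)) (∣-abs⇒∣ℤ q^r∣ξ)))
    where
    q^j·q^r≡N : q ℕ.^ j ℕ.* q ℕ.^ r ≡ N
    q^j·q^r≡N = ≡.trans (ℕP.*-comm (q ℕ.^ j) (q ℕ.^ r)) (q^r·q^j≡N r j r+j≡2k)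

  -- For q ∤ x, i ↦ i x mod q permutes [0, q), so it does not change sums over [0, q).
  Σ<-mult-permute : ∀ x → ¬ + q ∣ℤ x → (h : ℕ → Carrier) → Σ< q (λ i → h ((+ i ℤ.* x) %ℕ q)) ≈ Σ< q h
  Σ<-mult-permute x q∤x h =
    Σ<-permute q h (times x) (times y) (λ i _ → ℤDM.n%ℕd<d (+ i ℤ.* x) q) (λ i _ → ℤDM.n%ℕd<d (+ i ℤ.* y) q)
               (undo y x yx≡1) (undo x y (≡.subst (λ z → + q ∣ℤ z ℤ.- + 1) (ℤP.*-comm y x) yx≡1))
    where
    y : ℤ
    y = proj₁ (inverse-mod-q x q∤x)
    yx≡1 : + q ∣ℤ (y ℤ.* x) ℤ.- + 1
    yx≡1 = proj₂ (inverse-mod-q x q∤x)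
    times : ℤ → ℕ → ℕ
    times a i = (+ i ℤ.* a) %ℕ q
    regroup : ∀ P I A B → (P ℤ.* B) ℤ.- I ≡ ((P ℤ.- I ℤ.* A) ℤ.* B) ℤ.+ I ℤ.* ((A ℤ.* B) ℤ.- + 1)
    regroup = solve-∀
    undo : ∀ a b → + q ∣ℤ (a ℤ.* b) ℤ.- + 1 → ∀ i → i < q → times b (times a i) ≡ i
    undo a b ab≡1 i i<q = ≡.sym (%ℕ-unique q (+ times a i ℤ.* b) i<q (∣-sub-sym {X = + times a i ℤ.* b}
      (≡.subst (+ q ∣ℤ_) (≡.sym (regroup (+ times a i) (+ i) a b))
        (ℤS.∣m∣n⇒∣m+n (ℤS.∣m⇒∣m*n b (∣-sub-sym {X = + i ℤ.* a} (∣-residue q (+ i ℤ.* a))))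
                      (ℤS.∣n⇒∣m*n (+ i) ab≡1)))))

  -- Orthogonality: if q^v ∣ ξ exactly and g + v + 1 = 2k, then Σ_{i<q} e(i q^g ξ) = 0.
  -- With ξ = ξ' q^v and q ∤ ξ', e(i q^g ξ) = ζ^(π(i) q^(g+v)) where π(i) = i ξ' mod q, and π
  -- permutes [0, q); so the sum is Σ_{i<q} ζ^(i q^(2k-1)) = Φ_{q^(2k)}(ζ) = 0.
  orthogonality : ∀ g v → 2 ℕ.* k ≡ suc (g ℕ.+ v) → q ℕ.^ v ∣ ℤ.∣ ξ ∣ → ¬ q ℕ.^ suc v ∣ ℤ.∣ ξ ∣ →
    Σ< q (λ i → e (+ (i ℕ.* q ℕ.^ g) ℤ.* ξ)) ≈ 0#
  orthogonality g v 2k≡g+v+1 q^v∣ξ q^v+1∤ξ = begin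
    Σ< q (λ i → e (+ (i ℕ.* q ℕ.^ g) ℤ.* ξ)) ≈⟨ Σ<-cong q (λ i _ → sym (ψ∘π≈e i)) ⟩
    Σ< q (λ i → ψ (π i))                     ≈⟨ Σ<-mult-permute ξ' q∤ξ' ψ ⟩
    Σ< q ψ                                   ≈⟨ ≡.subst (λ m → CycloRoot q m ζ) 2k≡g+v+1 Φζ≈0 ⟩
    0#                                       ∎
    where
    ψ : ℕ → Carrier
    ψ i = pow ζ (i ℕ.* q ℕ.^ (g ℕ.+ v))
    q^v∣ℤξ : + (q ℕ.^ v) ∣ℤ ξ
    q^v∣ℤξ = ∣-abs⇒∣ℤ q^v∣ξ
    ξ' : ℤ
    ξ' = ℤS.quotient q^v∣ℤξ
    ξ≡ξ'q^v : ξ ≡ ξ' ℤ.* + (q ℕ.^ v)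
    ξ≡ξ'q^v = ℤS._∣_.equality q^v∣ℤξ
    q∤ξ' : ¬ + q ∣ℤ ξ'
    q∤ξ' q∣ξ' = q^v+1∤ξ (∣ℤ⇒∣-abs (≡.subst (+ (q ℕ.^ suc v) ∣ℤ_) (≡.sym ξ≡ξ'q^v)
                                   (∣ℤ-* q∣ξ' (ℤS.∣-refl {+ (q ℕ.^ v)}))))
    π : ℕ → ℕ
    π i = (+ i ℤ.* ξ') %ℕ q
    factor : ∀ P I X G V → (P ℤ.* (G ℤ.* V)) ℤ.- ((I ℤ.* G) ℤ.* (X ℤ.* V)) ≡ (P ℤ.- I ℤ.* X) ℤ.* (G ℤ.* V)
    factor = solve-∀
    q^[g+v]≡ : + (q ℕ.^ (g ℕ.+ v)) ≡ + (q ℕ.^ g) ℤ.* + (q ℕ.^ v)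
    q^[g+v]≡ = ≡.trans (≡.cong +_ (^-+ q g v)) (ℤP.pos-* (q ℕ.^ g) (q ℕ.^ v))
    difference : ∀ i → + (π i ℕ.* q ℕ.^ (g ℕ.+ v)) ℤ.- + (i ℕ.* q ℕ.^ g) ℤ.* ξ
                     ≡ (+ π i ℤ.- + i ℤ.* ξ') ℤ.* + (q ℕ.^ (g ℕ.+ v))
    difference i =
      ≡.trans (≡.cong₂ (λ A B → A ℤ.- B ℤ.* ξ) (≡.trans (ℤP.pos-* (π i) _) (≡.cong (+ π i ℤ.*_) q^[g+v]≡))
                                               (ℤP.pos-* i (q ℕ.^ g)))
      (≡.trans (≡.cong (λ X → (+ π i ℤ.* (+ (q ℕ.^ g) ℤ.* + (q ℕ.^ v))) ℤ.- (+ i ℤ.* + (q ℕ.^ g)) ℤ.* X) ξ≡ξ'q^v)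
      (≡.trans (factor (+ π i) (+ i) ξ' (+ (q ℕ.^ g)) (+ (q ℕ.^ v)))
               (≡.cong ((+ π i ℤ.- + i ℤ.* ξ') ℤ.*_) (≡.sym q^[g+v]≡))))
    -- π(i) q^(g+v) ≡ i q^g ξ (mod N), since q ∣ π(i) - i ξ' and N = q · q^(g+v).
    ψ∘π≈e : ∀ i → ψ (π i) ≈ e (+ (i ℕ.* q ℕ.^ g) ℤ.* ξ)
    ψ∘π≈e i = pow≈e (π i ℕ.* q ℕ.^ (g ℕ.+ v)) (+ (i ℕ.* q ℕ.^ g) ℤ.* ξ)
      (≡.subst₂ _∣ℤ_ (≡.cong (λ m → + (q ℕ.^ m)) (≡.sym 2k≡g+v+1)) (≡.sym (difference i))
                (∣ℤ-* (∣-sub-sym {X = + i ℤ.* ξ'} (∣-residue q (+ i ℤ.* ξ'))) ℤS.∣-refl))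

  -- Under the same hypotheses the sum over i < q^(v+1) vanishes too: for i = i₁ q + i₀
  -- the factor e(i₁ q^(g+1) ξ) is 1, as N = q^(g+1) q^v ∣ q^(g+1) ξ.
  orthogonality-extended : ∀ g v → 2 ℕ.* k ≡ suc (g ℕ.+ v) → q ℕ.^ v ∣ ℤ.∣ ξ ∣ → ¬ q ℕ.^ suc v ∣ ℤ.∣ ξ ∣ →
    Σ< (q ℕ.^ suc v) (λ i → e (+ (i ℕ.* q ℕ.^ g) ℤ.* ξ)) ≈ 0#
  orthogonality-extended g v 2k≡g+v+1 q^v∣ξ q^v+1∤ξ = begin
    Σ< (q ℕ.* q ℕ.^ v) A             ≡⟨ ≡.cong (λ M → Σ< M A) (ℕP.*-comm q (q ℕ.^ v)) ⟩
    Σ< (q ℕ.^ v ℕ.* q) A             ≈⟨ Σ<-factor (q ℕ.^ v) q A (λ _ → 1#) A split ⟩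
    Σ< (q ℕ.^ v) (λ _ → 1#) * Σ< q A ≈⟨ *-congˡ (orthogonality g v 2k≡g+v+1 q^v∣ξ q^v+1∤ξ) ⟩
    Σ< (q ℕ.^ v) (λ _ → 1#) * 0#     ≈⟨ zeroʳ _ ⟩
    0#                               ∎
    where
    A : ℕ → Carrier
    A i = e (+ (i ℕ.* q ℕ.^ g) ℤ.* ξ)
    digits : ∀ i₁ b i₀ G → (i₁ ℕ.* b ℕ.+ i₀) ℕ.* G ≡ i₁ ℕ.* (b ℕ.* G) ℕ.+ i₀ ℕ.* G
    digits = ℕSolver.solve-∀
    high-part≈1 : ∀ i₁ → e (+ (i₁ ℕ.* q ℕ.^ suc g) ℤ.* ξ) ≈ 1#
    high-part≈1 i₁ = e-1 (+ (i₁ ℕ.* q ℕ.^ suc g) ℤ.* ξ)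
      (≡.subst (_∣ℤ + (i₁ ℕ.* q ℕ.^ suc g) ℤ.* ξ) (≡.cong +_ (q^r·q^j≡N (suc g) v (≡.sym 2k≡g+v+1)))
               (∣ℤ-* (∣⇒∣ℤ (ℕD.n∣m*n i₁)) (∣-abs⇒∣ℤ q^v∣ξ)))
    split : ∀ i₁ i₀ → i₁ < q ℕ.^ v → i₀ < q → A (i₁ ℕ.* q ℕ.+ i₀) ≈ 1# * A i₀
    split i₁ i₀ _ _ = trans (reflexive (≡.cong (λ m → e (+ m ℤ.* ξ)) (digits i₁ q i₀ (q ℕ.^ g))))
                            (trans (e-+ξ (i₁ ℕ.* q ℕ.^ suc g) (i₀ ℕ.* q ℕ.^ g)) (*-congʳ (high-part≈1 i₁)))

  -- If q^r ∤ ξ and r + j = 2k, then S r j = 0: take q^v ∣ ξ exactly (v < r), write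
  -- r = (v + 1) + f and c = i q^f + c'; the sum over i is orthogonality-extended with g = f + j.
  S-vanish : ∀ r j → r ℕ.+ j ≡ 2 ℕ.* k → ¬ q ℕ.^ r ∣ ℤ.∣ ξ ∣ → S r j ≈ 0#
  S-vanish r j r+j≡2k q^r∤ξ with valuation-split q r ℤ.∣ ξ ∣
  ... | inj₁ q^r∣ξ = contradiction q^r∣ξ q^r∤ξ
  ... | inj₂ (v , v<r , q^v∣ξ , q^v+1∤ξ) = begin
    Σ< (q ℕ.^ r) F                      ≡⟨ ≡.cong (λ M → Σ< M F) q^r≡q^[v+1]·q^f ⟩
    Σ< (q ℕ.^ suc v ℕ.* q ℕ.^ f) F      ≈⟨ Σ<-factor (q ℕ.^ suc v) (q ℕ.^ f) F A F split ⟩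
    Σ< (q ℕ.^ suc v) A * Σ< (q ℕ.^ f) F ≈⟨ *-congʳ (orthogonality-extended (f ℕ.+ j) v 2k≡g+v+1 q^v∣ξ q^v+1∤ξ) ⟩
    0# * Σ< (q ℕ.^ f) F                 ≈⟨ zeroˡ _ ⟩
    0#                                  ∎
    where
    F : ℕ → Carrier
    F c = e (+ (c ℕ.* q ℕ.^ j) ℤ.* ξ)
    f : ℕ
    f = r ℕ.∸ suc v
    A : ℕ → Carrier
    A i = e (+ (i ℕ.* q ℕ.^ (f ℕ.+ j)) ℤ.* ξ)
    v+1+f≡r : suc v ℕ.+ f ≡ r
    v+1+f≡r = ℕP.m+[n∸m]≡n v<r
    rearrange : ∀ v f j → (v ℕ.+ f) ℕ.+ j ≡ (f ℕ.+ j) ℕ.+ v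
    rearrange = ℕSolver.solve-∀
    2k≡g+v+1 : 2 ℕ.* k ≡ suc ((f ℕ.+ j) ℕ.+ v)
    2k≡g+v+1 = ≡.trans (≡.sym r+j≡2k) (≡.trans (≡.cong (ℕ._+ j) (≡.sym v+1+f≡r)) (≡.cong suc (rearrange v f j)))
    q^r≡q^[v+1]·q^f : q ℕ.^ r ≡ q ℕ.^ suc v ℕ.* q ℕ.^ f
    q^r≡q^[v+1]·q^f = ≡.trans (≡.cong (q ℕ.^_) (≡.sym v+1+f≡r)) (^-+ q (suc v) f)
    digits : ∀ i F c J → (i ℕ.* F ℕ.+ c) ℕ.* J ≡ i ℕ.* (F ℕ.* J) ℕ.+ c ℕ.* J
    digits = ℕSolver.solve-∀
    split : ∀ i c → i < q ℕ.^ suc v → c < q ℕ.^ f → F (i ℕ.* q ℕ.^ f ℕ.+ c) ≈ A i * F c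
    split i c _ _ = trans (reflexive (≡.cong (λ m → e (+ m ℤ.* ξ))
                                       (≡.trans (digits i (q ℕ.^ f) c (q ℕ.^ j))
                                                (≡.cong (λ M → i ℕ.* M ℕ.+ c ℕ.* q ℕ.^ j) (≡.sym (^-+ q f j))))))
                          (e-+ξ (i ℕ.* q ℕ.^ (f ℕ.+ j)) (c ℕ.* q ℕ.^ j))

  Kl-no-root : ¬ δ (+ 4 ℤ.* n) N → K ≈ 0#
  Kl-no-root no-root = trans (reflexive (proj₂ Kl-as-sum))
    (Σ<-zero N λ a _ → T-nonroot a (λ a-root → no-root (+ a , ∣ℤ⇒∣-abs a-root)))

  k+k≡2k : k ℕ.+ k ≡ 2 ℕ.* k
  k+k≡2k = ≡.cong (k ℕ.+_) (≡.sym (ℕP.+-identityʳ k))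

  -- Case N ∣ n, q^k ∣ ξ: factor with r = j = k; S k k = q^k, and 0 is the only root below q^k.
  Kl-case1 : q ℕ.^ k ∣ ℤ.∣ ξ ∣ → N ∣ ℤ.∣ n ∣ → K ≈ ι (q ℕ.^ k)
  Kl-case1 q^k∣ξ N∣n = begin
    K                      ≈⟨ Kl-factor k k k+k≡2k ℕP.≤-refl roots-divisible ⟩
    S k k * Σ< (q ℕ.^ k) T ≈⟨ *-cong (S-full k k k+k≡2k q^k∣ξ) only-zero ⟩
    ι (q ℕ.^ k) * 1#       ≈⟨ *-identityʳ _ ⟩
    ι (q ℕ.^ k)            ∎
    where
    roots-divisible : ∀ a → Root a → q ℕ.^ k ∣ a
    roots-divisible = root-divisible k ℕP.≤-refl N∣n
    zero-root : Root 0
    zero-root = ≡.subst (+ N ∣ℤ_) (≡.sym (ℤP.+-identityˡ (ℤ.- (+ 4 ℤ.* n))))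
                  (ℤS.∣m⇒∣-m (ℤS.∣n⇒∣m*n (+ 4) (∣-abs⇒∣ℤ N∣n)))
    T0≈1 : T 0 ≈ 1#
    T0≈1 = trans (T-root 0 zero-root) (e-1 (+ 0 ℤ.* ξ) (ℤS.∣m⇒∣m*n ξ (ℤS.divides (+ 0) ≡.refl)))
    only-zero : Σ< (q ℕ.^ k) T ≈ 1#
    only-zero = Σ<-single (q ℕ.^ k) T (ℕP.m^n>0 q k) T0≈1
      (λ i i<q^k i≢0 → T-nonroot i (λ i-root → i≢0 (multiple-below i<q^k (roots-divisible i i-root))))

  -- Case n = q^(2r) t exactly, 2r < 2k, q^(2r) ∣ ξ², s² ≡ t (mod q^(2k-2r)): factor with r and
  -- j = 2k - r; S r j = q^r since q^r ∣ ξ, and the roots below q^j are ±b mod q^j, b = 2 q^r s.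
  Kl-case2 : ∀ r → 2 ℕ.* r < 2 ℕ.* k → ¬ q ℕ.^ suc (2 ℕ.* r) ∣ ℤ.∣ n ∣ → q ℕ.^ (2 ℕ.* r) ∣ ℤ.∣ ξ ℤ.* ξ ∣ →
    ∀ t s → n ≡ + (q ℕ.^ (2 ℕ.* r)) ℤ.* t → q ℕ.^ (2 ℕ.* k ℕ.∸ 2 ℕ.* r) ∣ ℤ.∣ (s ℤ.* s) ℤ.- t ∣ →
    K ≈ ι (q ℕ.^ r) * (e (+ 2 ℤ.* (+ (q ℕ.^ r) ℤ.* s) ℤ.* ξ) + e (ℤ.- (+ 2 ℤ.* (+ (q ℕ.^ r) ℤ.* s) ℤ.* ξ)))
  Kl-case2 r 2r<2k q^2r+1∤n q^2r∣ξ² t s n≡q^2rt s²≡t = begin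
    K                                               ≈⟨ Kl-factor r j r+j≡2k r≤j (root-divisible r r≤k q^2r∣n) ⟩
    S r j * Σ< (q ℕ.^ j) T                          ≈⟨ *-cong (S-full r j r+j≡2k q^r∣ξ) two-roots ⟩
    ι (q ℕ.^ r) * (e (b ℤ.* ξ) + e (ℤ.- (b ℤ.* ξ))) ∎
    where
    open TwoRoots r t s 2r<2k n≡q^2rt q^2r+1∤n s²≡t
    q^r∣ξ : q ℕ.^ r ∣ ℤ.∣ ξ ∣
    q^r∣ξ = square-root-∣ r ℤ.∣ ξ ∣ (≡.subst (q ℕ.^ (2 ℕ.* r) ∣_) (ℤP.abs-* ξ ξ) q^2r∣ξ²)
    T-u₁ : T u₁ ≈ e (b ℤ.* ξ)
    T-u₁ = trans (T-root u₁ u₁-root) (e-period r j r+j≡2k q^r∣ξ (+ u₁) b u₁≡b)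
    T-u₂ : T u₂ ≈ e (ℤ.- (b ℤ.* ξ))
    T-u₂ = trans (T-root u₂ u₂-root) (trans (e-period r j r+j≡2k q^r∣ξ (+ u₂) (ℤ.- b) u₂≡-b)
                                            (reflexive (≡.cong e (≡.sym (ℤP.neg-distribˡ-* b ξ)))))
    two-roots : Σ< (q ℕ.^ j) T ≈ e (b ℤ.* ξ) + e (ℤ.- (b ℤ.* ξ))
    two-roots = Σ<-pair (q ℕ.^ j) T u₁<q^j u₂<q^j u₁≢u₂ T-u₁ T-u₂
      (λ i i<q^j i≢u₁ i≢u₂ → T-nonroot i (λ i-root → Sum.[ i≢u₁ , i≢u₂ ] (root-cases i i<q^j i-root)))

  -- If every root is divisible by q^r (as when q^(2r) ∣ n, r ≤ k) but q^r ∤ ξ, then K = 0: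
  -- factor with r and j = (k - r) + k, and S r j vanishes.
  Kl-vanish : ∀ r → r ≤ k → q ℕ.^ (2 ℕ.* r) ∣ ℤ.∣ n ∣ → ¬ q ℕ.^ r ∣ ℤ.∣ ξ ∣ → K ≈ 0#
  Kl-vanish r r≤k q^2r∣n q^r∤ξ = begin
    K                      ≈⟨ Kl-factor r j r+j≡2k r≤j (root-divisible r r≤k q^2r∣n) ⟩
    S r j * Σ< (q ℕ.^ j) T ≈⟨ *-congʳ (S-vanish r j r+j≡2k q^r∤ξ) ⟩
    0# * Σ< (q ℕ.^ j) T    ≈⟨ zeroˡ _ ⟩
    0#                     ∎
    where
    j : ℕ
    j = (k ℕ.∸ r) ℕ.+ k
    r+j≡2k : r ℕ.+ j ≡ 2 ℕ.* k
    r+j≡2k = ≡.trans (≡.sym (ℕP.+-assoc r (k ℕ.∸ r) k)) (≡.trans (≡.cong (ℕ._+ k) (ℕP.m+[n∸m]≡n r≤k)) k+k≡2k)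
    r≤j : r ≤ j
    r≤j = ℕP.≤-trans r≤k (ℕP.m≤n+m k (k ℕ.∸ r))

  -- If 4n is a square modulo N but neither case 1 nor case 2 applies, then K = 0: either
  -- N ∣ n and q^k ∤ ξ, or q^m ∣ n exactly with m = 2r < 2k (m is even) and q^r ∤ ξ.
  Kl-otherwise : δ (+ 4 ℤ.* n) N → ¬ (q ℕ.^ k ∣ ℤ.∣ ξ ∣ × N ∣ ℤ.∣ n ∣) →
    ¬ (∃ λ m → m < 2 ℕ.* k × q ℕ.^ m ∣ ℤ.∣ n ∣ × ¬ q ℕ.^ suc m ∣ ℤ.∣ n ∣ × q ℕ.^ m ∣ ℤ.∣ ξ ℤ.* ξ ∣) → K ≈ 0#
  Kl-otherwise (x , x²≡4n) not-case1 not-case2 with valuation-split q (2 ℕ.* k) ℤ.∣ n ∣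
  ... | inj₁ N∣n = Kl-vanish k ℕP.≤-refl N∣n (λ q^k∣ξ → not-case1 (q^k∣ξ , N∣n))
  ... | inj₂ (m , m<2k , q^m∣n , q^m+1∤n) with even-valuation m x (∣-abs⇒∣ℤ x²≡4n) m<2k q^m∣n q^m+1∤n
  ...   | r , ≡.refl = Kl-vanish r r≤k q^m∣n (λ q^r∣ξ → not-case2 (m , m<2k , q^m∣n , q^m+1∤n , q^m∣ξ² q^r∣ξ))
    where
    r≤k : r ≤ k
    r≤k = ℕP.<⇒≤ (ℕP.*-cancelˡ-< 2 r k m<2k)
    q^m∣ξ² : q ℕ.^ r ∣ ℤ.∣ ξ ∣ → q ℕ.^ (2 ℕ.* r) ∣ ℤ.∣ ξ ℤ.* ξ ∣
    q^m∣ξ² q^r∣ξ = ≡.subst₂ _∣_ (≡.sym (^-double q r)) (≡.sym (ℤP.abs-* ξ ξ)) (ℕD.*-pres-∣ q^r∣ξ q^r∣ξ)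

lemmaB4 : ∀ {c ℓ} (R : CommutativeRing c ℓ) (q : ℕ) → Prime q → q ≢ 2 →
  (ξ n : ℤ) (k : ℕ) (ζ : CommutativeRing.Carrier R) →
  InRing.CycloRoot R q (2 ℕ.* k) ζ →
  let open CommutativeRing R
      open InRing R
      N = q ℕ.^ (2 ℕ.* k)
      K = Kl q k ζ ξ n
      case1 = ((+ (q ℕ.^ k)) ℤD.∣ ξ) × ((+ N) ℤD.∣ n)
      case2 = λ (m : ℕ) → (m < 2 ℕ.* k) × ((+ (q ℕ.^ m)) ℤD.∣ n)
                × (¬ ((+ (q ℕ.^ ℕ.suc m)) ℤD.∣ n)) × ((+ (q ℕ.^ m)) ℤD.∣ (ξ ℤ.* ξ))
  in (¬ δ (+ 4 ℤ.* n) N → K ≈ 0#)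
     × (δ (+ 4 ℤ.* n) N → case1 → K ≈ ι (q ℕ.^ k))
     × (δ (+ 4 ℤ.* n) N → (m : ℕ) → case2 m → (r : ℕ) → m ≡ 2 ℕ.* r →
          (t s : ℤ) → n ≡ (+ (q ℕ.^ (2 ℕ.* r))) ℤ.* t →
          (s ℤ.* s) ≡ t [mod q ℕ.^ (2 ℕ.* k ℕ.∸ 2 ℕ.* r) ] →
          K ≈ ι (q ℕ.^ r) * (pow ζ (res q (2 ℕ.* k) (+ 2 ℤ.* (+ (q ℕ.^ r) ℤ.* s) ℤ.* ξ))
                             + pow ζ (res q (2 ℕ.* k) (ℤ.- (+ 2 ℤ.* (+ (q ℕ.^ r) ℤ.* s) ℤ.* ξ)))))
     × (δ (+ 4 ℤ.* n) N → ¬ case1 → ¬ (∃ λ m → case2 m) → K ≈ 0#)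
lemmaB4 R zero    q-prime _   ξ n k ζ Φζ≈0 = contradiction q-prime ¬prime[0]
lemmaB4 R (suc p) q-prime q≢2 ξ n k ζ Φζ≈0 =
    Kl-no-root
  , (λ _ → uncurry Kl-case1)
  , (λ { _ m (m<2k , _ , q^m+1∤n , q^m∣ξ²) r ≡.refl → Kl-case2 r m<2k q^m+1∤n q^m∣ξ² })
  , Kl-otherwise
  where open Kloosterman R p q-prime q≢2 ξ n k ζ Φζ≈0
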